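{- Let $G(x)=\sum_{n\geq1}op_{n,n-1}(123)x^n$. Then \[G(x)=\frac{2x^2-7x+2+3x\sqrt{1-4x}-2\sqrt{1-4x}}{2x\sqrt{1-4x}}.\]
   Context: An ordered partition of $[n]=\{1,\dots,n\}$ with $k$ blocks is a sequence $B_1/\cdots/B_k$ of nonempty pairwise disjoint subsets of $[n]$ with union $[n]$. It contains the pattern $123$ if there are indices $i_1<i_2<i_3$ and elements $b_j\in B_{i_j}$ with $b_1<b_2<b_3$; otherwise it avoids $123$. $op_{n,k}(123)$ is the number of $123$-avoiding ordered partitions of $[n]$ with $k$ blocks. -}

module Defs where

open import Data.Bool using (Bool; true; false; _∧_; not)
open import Data.Nat as ℕ using (ℕ; zero; suc; _∸_)
open import Data.Fin as Fin using (Fin)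
open import Data.Fin.Properties using () renaming (_≟_ to _≟ᶠ_)
open import Data.Vec using (Vec; []; _∷_; lookup)
open import Data.List using (List; []; _∷_; [_]; map; concatMap; allFin; length; filterᵇ; upTo; foldr)
open import Data.Integer as ℤ using (ℤ; +_)
open import Relation.Nullary.Decidable using (⌊_⌋)
open import Relation.Nullary using (yes; no)
open import Data.Bool.ListAction using (all; any)
open import Relation.Binary.PropositionalEquality using (_≡_)
open import Data.Product using (_×_)

-- Ordered partitions of [n] with k blocks B_1/…/B_k are encoded by the
-- block-assignment map f : [n] → [k] (element a lies in block f a);
-- blocks are nonempty iff f is surjective.
-- Elements 1..n are Fin n (0-based), blocks 1..k are Fin k.

allMaps : (n k : ℕ) → List (Vec (Fin k) n)
allMaps zero    k = [ [] ]
allMaps (suc n) k = concatMap (λ v → map (λ b → b ∷ v) (allFin k)) (allMaps n k)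

_<ᵇ_ : ∀ {m} → Fin m → Fin m → Bool
i <ᵇ j = ⌊ i Fin.<? j ⌋

surjective : ∀ {n k} → Vec (Fin k) n → Bool
surjective {n} {k} f = all (λ j → any (λ a → ⌊ lookup f a ≟ᶠ j ⌋) (allFin n)) (allFin k)

contains123 : ∀ {n k} → Vec (Fin k) n → Bool
contains123 {n} f =
  any (λ a → any (λ b → any (λ c →
      (a <ᵇ b) ∧ (b <ᵇ c) ∧ (lookup f a <ᵇ lookup f b) ∧ (lookup f b <ᵇ lookup f c))
    (allFin n)) (allFin n)) (allFin n)

isAvoidingOP : ∀ {n k} → Vec (Fin k) n → Bool
isAvoidingOP f = surjective f ∧ not (contains123 f)

op123 : ℕ → ℕ → ℕ
op123 n k = length (filterᵇ isAvoidingOP (allMaps n k))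

PS : Set
PS = ℕ → ℤ

_⊕_ : PS → PS → PS
(f ⊕ g) n = f n ℤ.+ g n
infixl 6 _⊕_ _⊖_

_⊖_ : PS → PS → PS
(f ⊖ g) n = f n ℤ.- g n

_⊛_ : PS → PS → PS
(f ⊛ g) n = foldr ℤ._+_ (+ 0) (map (λ i → f i ℤ.* g (n ∸ i)) (upTo (suc n)))
infixl 7 _⊛_

mono : ℤ → ℕ → PS
mono c m n with m ℕ.≟ n
... | yes _ = c
... | no  _ = + 0

G : PS
G zero    = + 0
G (suc n) = + op123 (suc n) n

-- S is "a square root of 1-4x with constant term 1" (unique such series)
IsSqrt1-4x : PS → Set
IsSqrt1-4x S = (S 0 ≡ + 1) × (∀ n → (S ⊛ S) n ≡ (mono (+ 1) 0 ⊖ mono (+ 4) 1) n)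

module Submission where

-- Read an ordered partition of [n] into k blocks as the word f ∈ [k]ⁿ of block indices:
-- op_{n,k}(123) counts the words using every letter with no increasing subsequence of
-- length 3.  Refining by a bound b below which every ascent must start, the counts obey
-- a linear recurrence obtained by deleting the first letter c (the rest either still uses c,
-- or becomes a word on k - 1 letters once the gap at c is closed).  The recurrence is
-- solved for n = k by ballot numbers, the coefficients of powers of the Catalan series c,
-- and then for n = k + 1.  This gives G = x (c - c²) + x² (c² + c³)/√(1-4x), and the claim
-- follows from √(1-4x) = 1 - 2x c.

open import Defs
open import Relation.Binary.PropositionalEquality

module WordCounting where

  open import Data.Bool using (Bool; true; false; _∧_; _∨_; not; if_then_else_)
  open import Data.Bool.Properties using (∨-zeroʳ; ∨-identityʳ; ∨-assoc; ∧-zeroʳ; ∧-identityʳ; if-eta)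
  open import Data.Nat as ℕ using (ℕ; zero; suc; _+_; _*_; _∸_; _⊓_; _≤_; _<_; z≤n; s≤s)
  open import Data.Fin as Fin using (Fin; toℕ; punchIn)
  open import Data.Fin.Properties using (punchIn-injective; punchInᵢ≢i; toℕ<n; toℕ-fromℕ<) renaming (_≟_ to _≟ᶠ_)
  open import Data.Vec as Vec using (Vec; []; _∷_; lookup)
  open import Data.List as List using (List; []; _∷_)
  open import Data.Bool.ListAction using (all; any)
  open import Relation.Nullary using (yes; no; does; contradiction)
  open import Data.Sum using (inj₁; inj₂)
  open import Function using (_∘_)
  open import Relation.Nullary.Decidable using (⌊_⌋; isYes≗does; dec-true; dec-false)
  open import Data.Nat.ListAction using () renaming (sum to sumˡ)
  open import Data.Nat.ListAction.Properties using () renaming (sum-++ to sumˡ-++)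
  open import Data.List.Properties using (map-++; map-tabulate; map-cong)
  open import Data.Nat.Properties
    using (+-identityʳ; +-0-commutativeMonoid; ≤-refl; ≤-trans; <-≤-trans; ≮⇒≥; ≤-total; n≤1+n
          ; m≤n⇒m⊓n≡m; m≥n⇒m⊓n≡n; m⊓n≤m; +-assoc; ⊓-zeroʳ; ⊓-comm; m≤n⇒m≤1+n; ≰⇒>; <⇒≤; _≤?_
          ; +-comm; +-suc; +-cancelʳ-≡; m≤m+n)
  open import Data.Nat.Tactic.RingSolver using (solve-∀)
  open import Algebra.Properties.CommutativeMonoid.Sum +-0-commutativeMonoid
    using (sum; sum-syntax; sum-cong-≗; sum-replicate-zero; sum-remove; ∑-distrib-+; ∑-comm)

  anyᶠ : ∀ {n} → (Fin n → Bool) → Bool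
  anyᶠ {zero}  p = false
  anyᶠ {suc n} p = p Fin.zero ∨ anyᶠ (λ i → p (Fin.suc i))

  allᶠ : ∀ {n} → (Fin n → Bool) → Bool
  allᶠ {zero}  p = true
  allᶠ {suc n} p = p Fin.zero ∧ allᶠ (λ i → p (Fin.suc i))

  any-tabulate : ∀ {a} {A : Set a} {n} (p : A → Bool) (f : Fin n → A) →
                 any p (List.tabulate f) ≡ anyᶠ (λ i → p (f i))
  any-tabulate {n = zero}  p f = refl
  any-tabulate {n = suc n} p f = cong (p (f Fin.zero) ∨_) (any-tabulate p (λ i → f (Fin.suc i)))

  all-tabulate : ∀ {a} {A : Set a} {n} (p : A → Bool) (f : Fin n → A) →
                 all p (List.tabulate f) ≡ allᶠ (λ i → p (f i))
  all-tabulate {n = zero}  p f = refl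
  all-tabulate {n = suc n} p f = cong (p (f Fin.zero) ∧_) (all-tabulate p (λ i → f (Fin.suc i)))

  anyᶠ-cong : ∀ {n} {p q : Fin n → Bool} → (∀ i → p i ≡ q i) → anyᶠ p ≡ anyᶠ q
  anyᶠ-cong {zero}  eq = refl
  anyᶠ-cong {suc n} eq = cong₂ _∨_ (eq Fin.zero) (anyᶠ-cong (λ i → eq (Fin.suc i)))

  allᶠ-cong : ∀ {n} {p q : Fin n → Bool} → (∀ i → p i ≡ q i) → allᶠ p ≡ allᶠ q
  allᶠ-cong {zero}  eq = refl
  allᶠ-cong {suc n} eq = cong₂ _∧_ (eq Fin.zero) (allᶠ-cong (λ i → eq (Fin.suc i)))

  anyᶠ-∧ˡ : ∀ {n} (a : Bool) (p : Fin n → Bool) → anyᶠ (λ i → a ∧ p i) ≡ a ∧ anyᶠ p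
  anyᶠ-∧ˡ {zero}  false p = refl
  anyᶠ-∧ˡ {zero}  true  p = refl
  anyᶠ-∧ˡ {suc n} false p = anyᶠ-∧ˡ {n} false (λ i → p (Fin.suc i))
  anyᶠ-∧ˡ {suc n} true  p = refl

  allᶠ-true : ∀ {n} (p : Fin n → Bool) → allᶠ p ≡ true → ∀ i → p i ≡ true
  allᶠ-true p eq Fin.zero    with p Fin.zero
  ... | true = refl
  allᶠ-true p eq (Fin.suc i) with p Fin.zero
  ... | true = allᶠ-true (λ j → p (Fin.suc j)) eq i

  -- Unlike Data.Nat._≤ᵇ_, this reduces suc m ≤ᵇ suc n to m ≤ᵇ n definitionally.
  _≤ᵇ_ : ℕ → ℕ → Bool
  m ≤ᵇ n = m ℕ.<ᵇ suc n

  ≤⇒≤ᵇ : ∀ {m n} → m ≤ n → m ≤ᵇ n ≡ true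
  ≤⇒≤ᵇ z≤n     = refl
  ≤⇒≤ᵇ (s≤s p) = ≤⇒≤ᵇ p

  >⇒≤ᵇ-false : ∀ {m n} → n < m → m ≤ᵇ n ≡ false
  >⇒≤ᵇ-false {suc m} {zero}  _       = refl
  >⇒≤ᵇ-false {suc m} {suc n} (s≤s p) = >⇒≤ᵇ-false p

  ≤ᵇ⇒≤ : ∀ m n → m ≤ᵇ n ≡ true → m ≤ n
  ≤ᵇ⇒≤ zero    n       _  = z≤n
  ≤ᵇ⇒≤ (suc m) (suc n) eq = s≤s (≤ᵇ⇒≤ m n eq)

  module _ {k : ℕ} where

    occurs : ∀ {n} → Fin k → Vec (Fin k) n → Bool
    occurs j []      = false
    occurs j (y ∷ w) = ⌊ y ≟ᶠ j ⌋ ∨ occurs j w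

    allOccur : ∀ {n} → Vec (Fin k) n → Bool
    allOccur w = allᶠ (λ j → occurs j w)

    hasLetter≥ : ∀ {n} → ℕ → Vec (Fin k) n → Bool
    hasLetter≥ t []      = false
    hasLetter≥ t (y ∷ w) = (t ≤ᵇ toℕ y) ∨ hasLetter≥ t w

    hasAscent≥ : ∀ {n} → ℕ → Vec (Fin k) n → Bool
    hasAscent≥ t []      = false
    hasAscent≥ t (y ∷ w) = ((t ≤ᵇ toℕ y) ∧ hasLetter≥ (suc (toℕ y)) w) ∨ hasAscent≥ t w

    has123 : ∀ {n} → Vec (Fin k) n → Bool
    has123 []      = false
    has123 (y ∷ w) = hasAscent≥ (suc (toℕ y)) w ∨ has123 w

  surjective≡allOccur : ∀ {n k} (w : Vec (Fin k) n) → surjective w ≡ allOccur w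
  surjective≡allOccur {n} {k} w =
    trans (all-tabulate (λ j → any (λ a → ⌊ lookup w a ≟ᶠ j ⌋) (List.allFin n)) (λ j → j))
          (allᶠ-cong λ j → trans (any-tabulate (λ a → ⌊ lookup w a ≟ᶠ j ⌋) (λ a → a)) (occurs≡ j w))
    where
    occurs≡ : ∀ {n} (j : Fin k) (w : Vec (Fin k) n) → anyᶠ (λ a → ⌊ lookup w a ≟ᶠ j ⌋) ≡ occurs j w
    occurs≡ j []      = refl
    occurs≡ j (y ∷ w) = cong (⌊ y ≟ᶠ j ⌋ ∨_) (occurs≡ j w)

  module _ {k : ℕ} where
    private
      _<ᵗ_ : ∀ {m} → Fin m → Fin m → Bool
      i <ᵗ j = toℕ i ℕ.<ᵇ toℕ j

      ascentsAbove : ∀ {n} → Fin k → Vec (Fin k) n → Bool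
      ascentsAbove y w = anyᶠ λ b → anyᶠ λ c → (b <ᵗ c) ∧ (y <ᵗ lookup w b) ∧ (lookup w b <ᵗ lookup w c)

      triples : ∀ {n} → Vec (Fin k) n → Bool
      triples w = anyᶠ λ a → anyᶠ λ b → (a <ᵗ b) ∧ anyᶠ λ c →
        (b <ᵗ c) ∧ (lookup w a <ᵗ lookup w b) ∧ (lookup w b <ᵗ lookup w c)

      hasLetter≥-anyᶠ : ∀ {n} (z : Fin k) (w : Vec (Fin k) n) →
                        anyᶠ (λ c → z <ᵗ lookup w c) ≡ hasLetter≥ (suc (toℕ z)) w
      hasLetter≥-anyᶠ z []      = refl
      hasLetter≥-anyᶠ z (x ∷ w) = cong (_ ∨_) (hasLetter≥-anyᶠ z w)

      ascentsAbove≡ : ∀ {n} (y : Fin k) (w : Vec (Fin k) n) → ascentsAbove y w ≡ hasAscent≥ (suc (toℕ y)) w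
      ascentsAbove≡ y []      = refl
      ascentsAbove≡ y (z ∷ w) = cong₂ _∨_
        (trans (anyᶠ-∧ˡ (y <ᵗ z) (λ c → z <ᵗ lookup w c)) (cong ((y <ᵗ z) ∧_) (hasLetter≥-anyᶠ z w)))
        (ascentsAbove≡ y w)

      -- peeling off the first position is definitional for triples
      triples≡ : ∀ {n} (w : Vec (Fin k) n) → triples w ≡ has123 w
      triples≡ []      = refl
      triples≡ (y ∷ w) = cong₂ _∨_ (ascentsAbove≡ y w) (triples≡ w)

    contains123≡has123 : ∀ {n} (w : Vec (Fin k) n) → contains123 w ≡ has123 w
    contains123≡has123 {n} w = begin
        contains123 w
      ≡⟨ trans (any-tabulate (λ a → any (λ b → any (body a b) positions) positions) (λ a → a))
           (anyᶠ-cong λ a → trans (any-tabulate (λ b → any (body a b) positions) (λ b → b))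
           (anyᶠ-cong λ b → any-tabulate (body a b) (λ c → c))) ⟩
        (anyᶠ λ a → anyᶠ λ b → anyᶠ λ c → body a b c)
      ≡⟨ (anyᶠ-cong λ a → anyᶠ-cong λ b →
           trans (anyᶠ-cong λ c → cong (_∧ body′ a b c) (isYes≗does (a Fin.<? b))) (anyᶠ-∧ˡ (a <ᵗ b) (body′ a b))) ⟩
        (anyᶠ λ a → anyᶠ λ b → (a <ᵗ b) ∧ anyᶠ λ c → body′ a b c)
      ≡⟨ (anyᶠ-cong λ a → anyᶠ-cong λ b → cong ((a <ᵗ b) ∧_) (anyᶠ-cong λ c → cong₂ _∧_
           (isYes≗does (b Fin.<? c))
           (cong₂ _∧_ (isYes≗does (lookup w a Fin.<? lookup w b)) (isYes≗does (lookup w b Fin.<? lookup w c))))) ⟩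
        triples w
      ≡⟨ triples≡ w ⟩
        has123 w ∎
      where
      open ≡-Reasoning
      positions : List (Fin n)
      positions = List.allFin n
      body body′ : Fin n → Fin n → Fin n → Bool
      body a b c = (a <ᵇ b) ∧ (b <ᵇ c) ∧ (lookup w a <ᵇ lookup w b) ∧ (lookup w b <ᵇ lookup w c)
      body′ a b c = (b <ᵇ c) ∧ (lookup w a <ᵇ lookup w b) ∧ (lookup w b <ᵇ lookup w c)

  𝟙 : Bool → ℕ
  𝟙 true  = 1
  𝟙 false = 0

  Σʷ : ∀ n k → (Vec (Fin k) n → ℕ) → ℕ
  Σʷ zero    k g = g []
  Σʷ (suc n) k g = Σʷ n k (λ v → ∑[ c < k ] g (c ∷ v))

  length-filterᵇ : ∀ {a} {A : Set a} (p : A → Bool) xs → List.length (List.filterᵇ p xs) ≡ sumˡ (List.map (λ x → 𝟙 (p x)) xs)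
  length-filterᵇ p [] = refl
  length-filterᵇ p (x ∷ xs) with p x
  ... | true  = cong suc (length-filterᵇ p xs)
  ... | false = length-filterᵇ p xs

  sumˡ-concatMap : ∀ {a b} {A : Set a} {B : Set b} (g : B → ℕ) (h : A → List B) xs →
                   sumˡ (List.map g (List.concatMap h xs)) ≡ sumˡ (List.map (λ x → sumˡ (List.map g (h x))) xs)
  sumˡ-concatMap g h []       = refl
  sumˡ-concatMap g h (x ∷ xs) = begin
      sumˡ (List.map g (h x List.++ List.concatMap h xs))
    ≡⟨ cong sumˡ (map-++ g (h x) _) ⟩
      sumˡ (List.map g (h x) List.++ List.map g (List.concatMap h xs))
    ≡⟨ sumˡ-++ (List.map g (h x)) _ ⟩
      sumˡ (List.map g (h x)) + sumˡ (List.map g (List.concatMap h xs))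
    ≡⟨ cong (sumˡ (List.map g (h x)) +_) (sumˡ-concatMap g h xs) ⟩
      sumˡ (List.map (λ x → sumˡ (List.map g (h x))) (x ∷ xs)) ∎
    where open ≡-Reasoning

  sumˡ-tabulate : ∀ {n} (f : Fin n → ℕ) → sumˡ (List.tabulate f) ≡ ∑[ i < n ] f i
  sumˡ-tabulate {zero}  f = refl
  sumˡ-tabulate {suc n} f = cong (f Fin.zero +_) (sumˡ-tabulate (λ i → f (Fin.suc i)))

  sumˡ-allMaps : ∀ n k (g : Vec (Fin k) n → ℕ) → sumˡ (List.map g (allMaps n k)) ≡ Σʷ n k g
  sumˡ-allMaps zero    k g = +-identityʳ (g [])
  sumˡ-allMaps (suc n) k g = begin
      sumˡ (List.map g (allMaps (suc n) k))
    ≡⟨ sumˡ-concatMap g (λ v → List.map (_∷ v) (List.allFin k)) (allMaps n k) ⟩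
      sumˡ (List.map (λ v → sumˡ (List.map g (List.map (_∷ v) (List.allFin k)))) (allMaps n k))
    ≡⟨ cong sumˡ (map-cong (λ v → trans (cong sumˡ (trans (cong (List.map g) (map-tabulate (λ c → c) (_∷ v)))
         (map-tabulate (_∷ v) g))) (sumˡ-tabulate (λ c → g (c ∷ v)))) (allMaps n k)) ⟩
      sumˡ (List.map (λ v → ∑[ c < k ] g (c ∷ v)) (allMaps n k))
    ≡⟨ sumˡ-allMaps n k (λ v → ∑[ c < k ] g (c ∷ v)) ⟩
      Σʷ (suc n) k g ∎
    where open ≡-Reasoning

  Σʷ-cong : ∀ n k {g h : Vec (Fin k) n → ℕ} → (∀ w → g w ≡ h w) → Σʷ n k g ≡ Σʷ n k h
  Σʷ-cong zero    k eq = eq []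
  Σʷ-cong (suc n) k eq = Σʷ-cong n k (λ v → sum-cong-≗ (λ c → eq (c ∷ v)))

  Σʷ-zero : ∀ n k → Σʷ n k (λ _ → 0) ≡ 0
  Σʷ-zero zero    k = refl
  Σʷ-zero (suc n) k = trans (Σʷ-cong n k (λ _ → sum-replicate-zero k)) (Σʷ-zero n k)

  Σʷ-if : ∀ n k (b : Bool) (g : Vec (Fin k) n → ℕ) →
          Σʷ n k (λ w → if b then 0 else g w) ≡ (if b then 0 else Σʷ n k g)
  Σʷ-if n k true  g = Σʷ-zero n k
  Σʷ-if n k false g = refl

  Σʷ-+ : ∀ n k (g h : Vec (Fin k) n → ℕ) → Σʷ n k (λ w → g w + h w) ≡ Σʷ n k g + Σʷ n k h
  Σʷ-+ zero    k g h = refl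
  Σʷ-+ (suc n) k g h = trans (Σʷ-cong n k (λ v → ∑-distrib-+ (λ c → g (c ∷ v)) (λ c → h (c ∷ v))))
                             (Σʷ-+ n k _ _)

  Σʷ-∑ : ∀ n k m (g : Fin m → Vec (Fin k) n → ℕ) →
         Σʷ n k (λ w → ∑[ c < m ] g c w) ≡ ∑[ c < m ] Σʷ n k (g c)
  Σʷ-∑ zero    k m g = refl
  Σʷ-∑ (suc n) k m g = trans (Σʷ-cong n k (λ v → ∑-comm (λ y c → g c (y ∷ v))))
                             (Σʷ-∑ n k m (λ c v → ∑[ y < k ] g c (y ∷ v)))

  ∑-punchIn : ∀ {k} (c : Fin (suc k)) (h : Fin (suc k) → ℕ) →
              ∑[ y < suc k ] (if ⌊ y ≟ᶠ c ⌋ then 0 else h y) ≡ ∑[ y < k ] h (punchIn c y)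
  ∑-punchIn c h = trans (sum-remove {i = c} (λ y → if ⌊ y ≟ᶠ c ⌋ then 0 else h y)) (cong₂ _+_
    (cong (λ b → if b then 0 else h c) (trans (isYes≗does (c ≟ᶠ c)) (dec-true (c ≟ᶠ c) refl)))
    (sum-cong-≗ λ y → cong (λ b → if b then 0 else h (punchIn c y))
      (trans (isYes≗does (punchIn c y ≟ᶠ c)) (dec-false (punchIn c y ≟ᶠ c) (punchInᵢ≢i c y)))))

  Σʷ-punchIn : ∀ n k (c : Fin (suc k)) (g : Vec (Fin (suc k)) n → ℕ) →
               Σʷ n (suc k) (λ v → if occurs c v then 0 else g v) ≡ Σʷ n k (λ u → g (Vec.map (punchIn c) u))
  Σʷ-punchIn zero    k c g = refl
  Σʷ-punchIn (suc n) k c g =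
    trans (Σʷ-cong n (suc k) split) (Σʷ-punchIn n k c (λ v → ∑[ y < k ] g (punchIn c y ∷ v)))
    where
    split : ∀ v → ∑[ y < suc k ] (if occurs c (y ∷ v) then 0 else g (y ∷ v))
                ≡ (if occurs c v then 0 else ∑[ y < k ] g (punchIn c y ∷ v))
    split v with occurs c v
    ... | true  = trans (sum-cong-≗ λ y → cong (λ b → if b then 0 else g (y ∷ v)) (∨-zeroʳ ⌊ y ≟ᶠ c ⌋))
                       (sum-replicate-zero (suc k))
    ... | false = trans (sum-cong-≗ λ y → cong (λ b → if b then 0 else g (y ∷ v)) (∨-identityʳ ⌊ y ≟ᶠ c ⌋))
                       (∑-punchIn c (λ y → g (y ∷ v)))

  op123≡Σʷ : ∀ n k → op123 n k ≡ Σʷ n k (λ w → 𝟙 (allOccur w ∧ not (has123 w)))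
  op123≡Σʷ n k = begin
      op123 n k
    ≡⟨ length-filterᵇ isAvoidingOP (allMaps n k) ⟩
      sumˡ (List.map (λ w → 𝟙 (isAvoidingOP w)) (allMaps n k))
    ≡⟨ sumˡ-allMaps n k _ ⟩
      Σʷ n k (λ w → 𝟙 (isAvoidingOP w))
    ≡⟨ Σʷ-cong n k (λ w → cong₂ (λ s c → 𝟙 (s ∧ not c)) (surjective≡allOccur w) (contains123≡has123 w)) ⟩
      Σʷ n k (λ w → 𝟙 (allOccur w ∧ not (has123 w))) ∎
    where open ≡-Reasoning

  ≤ᵇ-⊓ : ∀ x y z → (x ⊓ y) ≤ᵇ z ≡ (x ≤ᵇ z) ∨ (y ≤ᵇ z)
  ≤ᵇ-⊓ zero    y       z       = refl
  ≤ᵇ-⊓ (suc x) zero    z       = sym (∨-zeroʳ (suc x ≤ᵇ z))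
  ≤ᵇ-⊓ (suc x) (suc y) zero    = refl
  ≤ᵇ-⊓ (suc x) (suc y) (suc z) = ≤ᵇ-⊓ x y z

  module _ {k : ℕ} where

    hasAscent≥-⊓ : ∀ {n} x y (w : Vec (Fin k) n) → hasAscent≥ x w ∨ hasAscent≥ y w ≡ hasAscent≥ (x ⊓ y) w
    hasAscent≥-⊓ x y []      = refl
    hasAscent≥-⊓ x y (z ∷ w) = trans
      (interchange (x ≤ᵇ toℕ z) (y ≤ᵇ toℕ z) (hasLetter≥ (suc (toℕ z)) w) (hasAscent≥ x w) (hasAscent≥ y w))
      (cong₂ (λ p q → (p ∧ hasLetter≥ (suc (toℕ z)) w) ∨ q) (sym (≤ᵇ-⊓ x y (toℕ z))) (hasAscent≥-⊓ x y w))
      where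
      interchange : ∀ p q g a b → ((p ∧ g) ∨ a) ∨ ((q ∧ g) ∨ b) ≡ ((p ∨ q) ∧ g) ∨ (a ∨ b)
      interchange true  true  true  a b = refl
      interchange true  true  false a b = refl
      interchange true  false g     a b = ∨-assoc g a b
      interchange false true  true  a b = ∨-zeroʳ a
      interchange false true  false a b = refl
      interchange false false g     a b = refl

    occurs⇒hasLetter≥ : ∀ {n} t (j : Fin k) (w : Vec (Fin k) n) →
                        occurs j w ≡ true → t ≤ᵇ toℕ j ≡ true → hasLetter≥ t w ≡ true
    occurs⇒hasLetter≥ t j (y ∷ w) occ t≤j with y ≟ᶠ j
    ... | yes refl = cong (_∨ hasLetter≥ t w) t≤j
    ... | no  _    = trans (cong ((t ≤ᵇ toℕ y) ∨_) (occurs⇒hasLetter≥ t j w occ t≤j)) (∨-zeroʳ (t ≤ᵇ toℕ y))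

    hasLetter≥-false : ∀ {n} t (w : Vec (Fin k) n) → k ≤ t → hasLetter≥ t w ≡ false
    hasLetter≥-false t []      _   = refl
    hasLetter≥-false t (y ∷ w) k≤t = cong₂ _∨_ (>⇒≤ᵇ-false (<-≤-trans (toℕ<n y) k≤t)) (hasLetter≥-false t w k≤t)

    hasLetter≥-allOccur : ∀ {n} t (w : Vec (Fin k) n) → allOccur w ≡ true → hasLetter≥ t w ≡ (t ℕ.<ᵇ k)
    hasLetter≥-allOccur t w onto with t ℕ.<? k
    ... | yes t<k = trans (occurs⇒hasLetter≥ t (Fin.fromℕ< t<k) w (allᶠ-true _ onto (Fin.fromℕ< t<k))
                            (trans (cong (t ≤ᵇ_) (toℕ-fromℕ< t<k)) (≤⇒≤ᵇ (≤-refl {t}))))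
                          (sym (≤⇒≤ᵇ t<k))
    ... | no  t≮k = trans (hasLetter≥-false t w (≮⇒≥ t≮k)) (sym (>⇒≤ᵇ-false (s≤s (≮⇒≥ t≮k))))

    hasAscent≥-false : ∀ {n} t (w : Vec (Fin k) n) → k ≤ suc t → hasAscent≥ t w ≡ false
    hasAscent≥-false t []      _ = refl
    hasAscent≥-false t (y ∷ w) k≤1+t with t ≤ᵇ toℕ y in t≤y
    ... | false = hasAscent≥-false t w k≤1+t
    ... | true  = cong₂ _∨_
      (hasLetter≥-false (suc (toℕ y)) w (≤-trans k≤1+t (s≤s (≤ᵇ⇒≤ t (toℕ y) t≤y))))
      (hasAscent≥-false t w k≤1+t)

  module _ {k K : ℕ} (f : Fin k → Fin K) where

    hasLetter≥-map : ∀ {n} t t′ → (∀ y → t ≤ᵇ toℕ (f y) ≡ t′ ≤ᵇ toℕ y) →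
                     (w : Vec (Fin k) n) → hasLetter≥ t (Vec.map f w) ≡ hasLetter≥ t′ w
    hasLetter≥-map t t′ eq []      = refl
    hasLetter≥-map t t′ eq (y ∷ w) = cong₂ _∨_ (eq y) (hasLetter≥-map t t′ eq w)

    module _ (f-<ᵇ : ∀ x y → (toℕ (f x) ℕ.<ᵇ toℕ (f y)) ≡ (toℕ x ℕ.<ᵇ toℕ y)) where

      hasAscent≥-map : ∀ {n} t t′ → (∀ y → t ≤ᵇ toℕ (f y) ≡ t′ ≤ᵇ toℕ y) →
                       (w : Vec (Fin k) n) → hasAscent≥ t (Vec.map f w) ≡ hasAscent≥ t′ w
      hasAscent≥-map t t′ eq []      = refl
      hasAscent≥-map t t′ eq (y ∷ w) = cong₂ _∨_
        (cong₂ _∧_ (eq y) (hasLetter≥-map (suc (toℕ (f y))) (suc (toℕ y)) (f-<ᵇ y) w))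
        (hasAscent≥-map t t′ eq w)

      has123-map : ∀ {n} (w : Vec (Fin k) n) → has123 (Vec.map f w) ≡ has123 w
      has123-map []      = refl
      has123-map (y ∷ w) = cong₂ _∨_ (hasAscent≥-map (suc (toℕ (f y))) (suc (toℕ y)) (f-<ᵇ y) w) (has123-map w)

  punchIn-<ᵇ : ∀ {k} (c : Fin (suc k)) x y → (toℕ (punchIn c x) ℕ.<ᵇ toℕ (punchIn c y)) ≡ (toℕ x ℕ.<ᵇ toℕ y)
  punchIn-<ᵇ Fin.zero    x           y           = refl
  punchIn-<ᵇ (Fin.suc c) Fin.zero    Fin.zero    = refl
  punchIn-<ᵇ (Fin.suc c) Fin.zero    (Fin.suc y) = refl
  punchIn-<ᵇ (Fin.suc c) (Fin.suc x) Fin.zero    = refl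
  punchIn-<ᵇ (Fin.suc c) (Fin.suc x) (Fin.suc y) = punchIn-<ᵇ c x y

  punchIn-≤ᵇ : ∀ {k} (c : Fin (suc k)) y t → t ≤ suc (toℕ c) → t ≤ᵇ toℕ (punchIn c y) ≡ (t ⊓ toℕ c) ≤ᵇ toℕ y
  punchIn-≤ᵇ c           y           zero    _             = refl
  punchIn-≤ᵇ Fin.zero    y           (suc zero) _          = refl
  punchIn-≤ᵇ Fin.zero    y           (suc (suc t)) (s≤s ())
  punchIn-≤ᵇ (Fin.suc c) Fin.zero    (suc t) _             = refl
  punchIn-≤ᵇ (Fin.suc c) (Fin.suc y) (suc t) (s≤s t≤1+c)   = punchIn-≤ᵇ c y t t≤1+c

  occurs-punchIn : ∀ {n k} (c : Fin (suc k)) (j : Fin k) (u : Vec (Fin k) n) →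
                   occurs (punchIn c j) (Vec.map (punchIn c) u) ≡ occurs j u
  occurs-punchIn c j []      = refl
  occurs-punchIn c j (y ∷ u) = cong₂ _∨_ (trans (isYes≗does _) (trans (≡ᵇ-injective y j) (sym (isYes≗does (y ≟ᶠ j))))) (occurs-punchIn c j u)
    where
    ≡ᵇ-injective : ∀ x y → does (punchIn c x ≟ᶠ punchIn c y) ≡ does (x ≟ᶠ y)
    ≡ᵇ-injective x y with x ≟ᶠ y
    ... | yes refl = dec-true (punchIn c x ≟ᶠ punchIn c x) refl
    ... | no  x≢y  = dec-false (punchIn c x ≟ᶠ punchIn c y) (x≢y ∘ punchIn-injective c x y)

  allOccur-∷-punchIn : ∀ {n k} (c : Fin (suc k)) (u : Vec (Fin k) n) →
                       allOccur (c ∷ Vec.map (punchIn c) u) ≡ allOccur u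
  allOccur-∷-punchIn c u = trans (allᶠ-remove c {λ j → occurs j (Vec.map (punchIn c) u)}) (allᶠ-cong λ j → occurs-punchIn c j u)
    where
    allᶠ-remove : ∀ {k} (c : Fin (suc k)) {h : Fin (suc k) → Bool} →
                  allᶠ (λ y → ⌊ c ≟ᶠ y ⌋ ∨ h y) ≡ allᶠ (λ y → h (punchIn c y))
    allᶠ-remove Fin.zero          = refl
    allᶠ-remove {suc k} (Fin.suc c) {h} = cong (h Fin.zero ∧_)
      (trans (allᶠ-cong λ y → cong (_∨ h (Fin.suc y)) (trans (isYes≗does (Fin.suc c ≟ᶠ Fin.suc y)) (sym (isYes≗does (c ≟ᶠ y)))))
             (allᶠ-remove c {λ y → h (Fin.suc y)}))

  boundedAvoider : ∀ {n k} → ℕ → Vec (Fin k) n → Bool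
  boundedAvoider b w = allOccur w ∧ not (has123 w) ∧ not (hasAscent≥ b w)

  -- N n k b counts the 123-avoiding words in (Fin k)ⁿ that use every letter and whose
  -- ascents all start below b; for b ≥ k - 1 the last condition is void.
  N : ℕ → ℕ → ℕ → ℕ
  N n k b = Σʷ n k (λ w → 𝟙 (boundedAvoider b w))

  N-saturated : ∀ n k b → k ≤ suc b → N n k b ≡ Σʷ n k (λ w → 𝟙 (allOccur w ∧ not (has123 w)))
  N-saturated n k b k≤1+b = Σʷ-cong n k λ w → cong (λ a → 𝟙 (allOccur w ∧ a))
    (trans (cong (λ a → not (has123 w) ∧ not a) (hasAscent≥-false b w k≤1+b)) (∧-identityʳ (not (has123 w))))

  op123≡N : ∀ n k b → k ≤ suc b → op123 n k ≡ N n k b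
  op123≡N n k b k≤1+b = trans (op123≡Σʷ n k) (sym (N-saturated n k b k≤1+b))

  N-saturated₂ : ∀ n k b b′ → k ≤ suc b → k ≤ suc b′ → N n k b ≡ N n k b′
  N-saturated₂ n k b b′ k≤1+b k≤1+b′ = trans (N-saturated n k b k≤1+b) (sym (N-saturated n k b′ k≤1+b′))

  N-⊓ : ∀ n k m b → k ≤ suc m → N n k (m ⊓ b) ≡ N n k b
  N-⊓ n k m b k≤1+m with ≤-total m b
  ... | inj₁ m≤b = trans (cong (N n k) (m≤n⇒m⊓n≡m m≤b)) (N-saturated₂ n k m b k≤1+m (≤-trans k≤1+m (s≤s m≤b)))
  ... | inj₂ b≤m = cong (N n k) (m≥n⇒m⊓n≡n b≤m)

  𝟙-split : ∀ s a₁ h g a₂ → 𝟙 (s ∧ not (a₁ ∨ h) ∧ not (g ∨ a₂)) ≡ (if g then 0 else 𝟙 (s ∧ not h ∧ not (a₁ ∨ a₂)))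
  𝟙-split false a₁    h false a₂ = refl
  𝟙-split false a₁    h true  a₂ = refl
  𝟙-split true  a₁    h true  a₂ = cong 𝟙 (∧-zeroʳ (not (a₁ ∨ h)))
  𝟙-split true  true  h false a₂ = sym (cong 𝟙 (∧-zeroʳ (not h)))
  𝟙-split true  false h false a₂ = refl

  𝟙-allOccur-∷ : ∀ {n k} (c : Fin k) (v : Vec (Fin k) n) x →
                 𝟙 (allOccur (c ∷ v) ∧ x) ≡ 𝟙 (allOccur v ∧ x) + (if occurs c v then 0 else 𝟙 (allOccur (c ∷ v) ∧ x))
  𝟙-allOccur-∷ c v x with occurs c v in c∈v
  ... | true  = trans (cong (λ s → 𝟙 (s ∧ x)) (allᶠ-cong c-redundant)) (sym (+-identityʳ _))
    where
    c-redundant : ∀ j → (⌊ c ≟ᶠ j ⌋ ∨ occurs j v) ≡ occurs j v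
    c-redundant j with c ≟ᶠ j
    ... | yes refl = sym c∈v
    ... | no  _    = refl
  ... | false with allOccur v in onto
  ...   | false = refl
  ...   | true  = contradiction (trans (sym c∈v) (allᶠ-true _ onto c)) λ ()

  module _ {n k : ℕ} (c : Fin (suc k)) (b : ℕ) where
    private
      c′ = toℕ c

      blocked : Bool
      blocked = (b ≤ᵇ c′) ∧ (c′ ℕ.<ᵇ k)

    𝟙-boundedAvoider-∷-allOccur : (v : Vec (Fin (suc k)) n) →
      𝟙 (allOccur v ∧ not (has123 (c ∷ v)) ∧ not (hasAscent≥ b (c ∷ v)))
        ≡ (if blocked then 0 else 𝟙 (boundedAvoider (suc c′ ⊓ b) v))
    𝟙-boundedAvoider-∷-allOccur v with allOccur v in onto
    ... | false = sym (if-eta blocked)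
    ... | true  = trans
      (𝟙-split true (hasAscent≥ (suc c′) v) (has123 v) ((b ≤ᵇ c′) ∧ hasLetter≥ (suc c′) v) (hasAscent≥ b v))
      (cong₂ (λ g a → if g then 0 else 𝟙 (not (has123 v) ∧ not a))
        (cong ((b ≤ᵇ c′) ∧_) (hasLetter≥-allOccur (suc c′) v onto)) (hasAscent≥-⊓ (suc c′) b v))

    𝟙-boundedAvoider-∷-punchIn : (u : Vec (Fin k) n) →
      𝟙 (boundedAvoider b (c ∷ Vec.map (punchIn c) u)) ≡ (if blocked then 0 else 𝟙 (boundedAvoider (suc c′ ⊓ b ⊓ c′) u))
    𝟙-boundedAvoider-∷-punchIn u = begin
        𝟙 (boundedAvoider b (c ∷ v))
      ≡⟨ 𝟙-split (allOccur (c ∷ v)) (hasAscent≥ (suc c′) v) (has123 v) ((b ≤ᵇ c′) ∧ hasLetter≥ (suc c′) v) (hasAscent≥ b v) ⟩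
        (if (b ≤ᵇ c′) ∧ hasLetter≥ (suc c′) v then 0 else
          𝟙 (allOccur (c ∷ v) ∧ not (has123 v) ∧ not (hasAscent≥ (suc c′) v ∨ hasAscent≥ b v)))
      ≡⟨ cong₂ (λ g x → if (b ≤ᵇ c′) ∧ g then 0 else 𝟙 x) letters
           (cong₂ (λ s x → s ∧ x) (allOccur-∷-punchIn c u) (cong₂ (λ h a → not h ∧ not a) same123 ascents)) ⟩
        (if (b ≤ᵇ c′) ∧ hasLetter≥ c′ u then 0 else 𝟙 (boundedAvoider (suc c′ ⊓ b ⊓ c′) u))
      ≡⟨ unblock ⟩
        (if blocked then 0 else 𝟙 (boundedAvoider (suc c′ ⊓ b ⊓ c′) u)) ∎
      where
      open ≡-Reasoning
      v = Vec.map (punchIn c) u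
      letters : hasLetter≥ (suc c′) v ≡ hasLetter≥ c′ u
      letters = hasLetter≥-map (punchIn c) (suc c′) c′
        (λ y → trans (punchIn-≤ᵇ c y (suc c′) ≤-refl) (cong (_≤ᵇ toℕ y) (m≥n⇒m⊓n≡n (n≤1+n c′)))) u
      same123 : has123 v ≡ has123 u
      same123 = has123-map (punchIn c) (punchIn-<ᵇ c) u
      ascents : hasAscent≥ (suc c′) v ∨ hasAscent≥ b v ≡ hasAscent≥ (suc c′ ⊓ b ⊓ c′) u
      ascents = trans (hasAscent≥-⊓ (suc c′) b v) (hasAscent≥-map (punchIn c) (punchIn-<ᵇ c) (suc c′ ⊓ b) _
        (λ y → punchIn-≤ᵇ c y (suc c′ ⊓ b) (m⊓n≤m (suc c′) b)) u)
      unblock : (if (b ≤ᵇ c′) ∧ hasLetter≥ c′ u then 0 else 𝟙 (boundedAvoider (suc c′ ⊓ b ⊓ c′) u))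
              ≡ (if blocked then 0 else 𝟙 (boundedAvoider (suc c′ ⊓ b ⊓ c′) u))
      unblock with allOccur u in onto
      ... | false = trans (if-eta _) (sym (if-eta blocked))
      ... | true  = cong (λ g → if (b ≤ᵇ c′) ∧ g then 0 else 𝟙 (not (has123 u) ∧ not (hasAscent≥ (suc c′ ⊓ b ⊓ c′) u)))
                         (hasLetter≥-allOccur c′ u onto)

    Σʷ-first-letter : Σʷ n (suc k) (λ v → 𝟙 (boundedAvoider b (c ∷ v)))
                    ≡ (if blocked then 0 else N n (suc k) (suc c′ ⊓ b) + N n k (suc c′ ⊓ b ⊓ c′))
    Σʷ-first-letter = begin
        Σʷ n (suc k) (λ v → 𝟙 (boundedAvoider b (c ∷ v)))
      ≡⟨ Σʷ-cong n (suc k) (λ v → 𝟙-allOccur-∷ c v (rest v)) ⟩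
        Σʷ n (suc k) (λ v → 𝟙 (allOccur v ∧ rest v) + (if occurs c v then 0 else 𝟙 (boundedAvoider b (c ∷ v))))
      ≡⟨ Σʷ-+ n (suc k) _ _ ⟩
        Σʷ n (suc k) (λ v → 𝟙 (allOccur v ∧ rest v))
          + Σʷ n (suc k) (λ v → if occurs c v then 0 else 𝟙 (boundedAvoider b (c ∷ v)))
      ≡⟨ cong₂ _+_
           (trans (Σʷ-cong n (suc k) 𝟙-boundedAvoider-∷-allOccur) (Σʷ-if n (suc k) blocked _))
           (trans (Σʷ-punchIn n k c _)
             (trans (Σʷ-cong n k 𝟙-boundedAvoider-∷-punchIn) (Σʷ-if n k blocked _))) ⟩
        (if blocked then 0 else N n (suc k) (suc c′ ⊓ b)) + (if blocked then 0 else N n k (suc c′ ⊓ b ⊓ c′))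
      ≡⟨ if-+ blocked ⟩
        (if blocked then 0 else N n (suc k) (suc c′ ⊓ b) + N n k (suc c′ ⊓ b ⊓ c′)) ∎
      where
      open ≡-Reasoning
      rest : Vec (Fin (suc k)) n → Bool
      rest v = not (has123 (c ∷ v)) ∧ not (hasAscent≥ b (c ∷ v))
      if-+ : ∀ β {x y} → (if β then 0 else x) + (if β then 0 else y) ≡ (if β then 0 else x + y)
      if-+ true  = refl
      if-+ false = refl

  N-suc : ∀ n k b → N (suc n) (suc k) b ≡
    ∑[ c < suc k ] (if (b ≤ᵇ toℕ c) ∧ (toℕ c ℕ.<ᵇ k) then 0 else
                     N n (suc k) (suc (toℕ c) ⊓ b) + N n k (suc (toℕ c) ⊓ b ⊓ toℕ c))
  N-suc n k b = trans (Σʷ-∑ n (suc k) (suc k) (λ c v → 𝟙 (boundedAvoider b (c ∷ v))))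
                      (sum-cong-≗ (λ c → Σʷ-first-letter {n} c b))

  Σ< : ℕ → (ℕ → ℕ) → ℕ
  Σ< m f = ∑[ i < m ] f (toℕ i)

  Σ<-last : ∀ m f → Σ< (suc m) f ≡ Σ< m f + f m
  Σ<-last zero    f = +-identityʳ (f 0)
  Σ<-last (suc m) f = trans (cong (f 0 +_) (Σ<-last m (λ i → f (suc i)))) (sym (+-assoc (f 0) _ _))

  Σ<-cong : ∀ m {f g : ℕ → ℕ} → (∀ i → i < m → f i ≡ g i) → Σ< m f ≡ Σ< m g
  Σ<-cong m eq = sum-cong-≗ (λ i → eq (toℕ i) (toℕ<n i))

  Σ<-zero : ∀ m {f : ℕ → ℕ} → (∀ i → i < m → f i ≡ 0) → Σ< m f ≡ 0
  Σ<-zero m eq = trans (Σ<-cong m eq) (sum-replicate-zero m)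

  ≤ᵇ-false⇒> : ∀ m n → m ≤ᵇ n ≡ false → n < m
  ≤ᵇ-false⇒> zero    n       ()
  ≤ᵇ-false⇒> (suc m) zero    _  = s≤s z≤n
  ≤ᵇ-false⇒> (suc m) (suc n) eq = s≤s (≤ᵇ-false⇒> m n eq)

  Σ<-below : ∀ k b (Y : ℕ → ℕ) → Σ< k (λ i → if b ≤ᵇ i then 0 else Y i) ≡ Σ< (b ⊓ k) Y
  Σ<-below zero    b Y = cong (λ m → Σ< m Y) (sym (⊓-zeroʳ b))
  Σ<-below (suc k) b Y with b ≤? k
  ... | yes b≤k = begin
      Σ< (suc k) T                       ≡⟨ Σ<-last k T ⟩
      Σ< k T + (if b ≤ᵇ k then 0 else Y k) ≡⟨ cong₂ _+_ (Σ<-below k b Y) (cong (λ β → if β then 0 else Y k) (≤⇒≤ᵇ b≤k)) ⟩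
      Σ< (b ⊓ k) Y + 0                   ≡⟨ +-identityʳ _ ⟩
      Σ< (b ⊓ k) Y                       ≡⟨ cong (λ m → Σ< m Y) (trans (m≤n⇒m⊓n≡m b≤k) (sym (m≤n⇒m⊓n≡m (m≤n⇒m≤1+n b≤k)))) ⟩
      Σ< (b ⊓ suc k) Y                   ∎
    where
    open ≡-Reasoning
    T = λ i → if b ≤ᵇ i then 0 else Y i
  ... | no  b≰k = begin
      Σ< (suc k) T                       ≡⟨ Σ<-last k T ⟩
      Σ< k T + (if b ≤ᵇ k then 0 else Y k) ≡⟨ cong₂ _+_ (Σ<-below k b Y) (cong (λ β → if β then 0 else Y k) (>⇒≤ᵇ-false (≰⇒> b≰k))) ⟩
      Σ< (b ⊓ k) Y + Y k                 ≡⟨ cong (λ m → Σ< m Y + Y k) (m≥n⇒m⊓n≡n (<⇒≤ (≰⇒> b≰k))) ⟩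
      Σ< k Y + Y k                       ≡⟨ sym (Σ<-last k Y) ⟩
      Σ< (suc k) Y                       ≡⟨ cong (λ m → Σ< m Y) (sym (m≥n⇒m⊓n≡n (≰⇒> b≰k))) ⟩
      Σ< (b ⊓ suc k) Y                   ∎
    where
    open ≡-Reasoning
    T = λ i → if b ≤ᵇ i then 0 else Y i

  -- the first letter c < k contributes only when c < b; the last letter c = k is never blocked
  N-rec : ∀ n k b → N (suc n) (suc k) b ≡
          Σ< (b ⊓ k) (λ c → N n (suc k) (suc c) + N n k c) + (N n (suc k) b + N n k b)
  N-rec n k b = begin
      N (suc n) (suc k) b
    ≡⟨ trans (N-suc n k b) (Σ<-last k T) ⟩
      Σ< k T + T k
    ≡⟨ cong₂ _+_ (trans (Σ<-cong k early) (Σ<-below k b Y)) last ⟩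
      Σ< (b ⊓ k) Y + (N n (suc k) b + N n k b) ∎
    where
    open ≡-Reasoning
    T Y : ℕ → ℕ
    T c = if (b ≤ᵇ c) ∧ (c ℕ.<ᵇ k) then 0 else N n (suc k) (suc c ⊓ b) + N n k (suc c ⊓ b ⊓ c)
    Y c = N n (suc k) (suc c) + N n k c
    early : ∀ c → c < k → T c ≡ (if b ≤ᵇ c then 0 else Y c)
    early c c<k rewrite ≤⇒≤ᵇ c<k | ∧-identityʳ (b ≤ᵇ c) with b ≤ᵇ c in b≰c
    ... | true  = refl
    ... | false = cong₂ (λ x y → N n (suc k) x + N n k y) c+1⊓b (trans (cong (_⊓ c) c+1⊓b) (m≥n⇒m⊓n≡n (n≤1+n c)))
      where
      c+1⊓b : suc c ⊓ b ≡ suc c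
      c+1⊓b = m≤n⇒m⊓n≡m (≤ᵇ-false⇒> b c b≰c)
    last : T k ≡ N n (suc k) b + N n k b
    last rewrite >⇒≤ᵇ-false {suc k} {k} ≤-refl | ∧-zeroʳ (b ≤ᵇ k) = cong₂ _+_
      (N-⊓ n (suc k) (suc k) b (n≤1+n (suc k)))
      (begin
        N n k (suc k ⊓ b ⊓ k)   ≡⟨ cong (N n k) (⊓-comm (suc k ⊓ b) k) ⟩
        N n k (k ⊓ (suc k ⊓ b)) ≡⟨ N-⊓ n k k (suc k ⊓ b) (n≤1+n k) ⟩
        N n k (suc k ⊓ b)       ≡⟨ N-⊓ n k (suc k) b (m≤n⇒m≤1+n (n≤1+n k)) ⟩
        N n k b                 ∎)

  N-vanish : ∀ n k b → n < k → N n k b ≡ 0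
  N-vanish zero    (suc k) b _         = refl
  N-vanish (suc n) (suc k) b (s≤s n<k) = begin
      N (suc n) (suc k) b
    ≡⟨ N-rec n k b ⟩
      Σ< (b ⊓ k) (λ c → N n (suc k) (suc c) + N n k c) + (N n (suc k) b + N n k b)
    ≡⟨ cong₂ _+_ (Σ<-zero (b ⊓ k) (λ c _ → cong₂ _+_ (N-vanish n (suc k) (suc c) n<k+1) (N-vanish n k c n<k)))
                 (cong₂ _+_ (N-vanish n (suc k) b n<k+1) (N-vanish n k b n<k)) ⟩
      0 ∎
    where
    open ≡-Reasoning
    n<k+1 = m≤n⇒m≤1+n n<k

  N-rec-step : ∀ n k b → suc b ≤ k →
    N (suc n) (suc k) (suc b) + N n (suc k) b ≡ N (suc n) (suc k) b + 2 * N n (suc k) (suc b) + N n k (suc b)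
  N-rec-step n k b b<k = begin
      N (suc n) (suc k) (suc b) + N n (suc k) b
    ≡⟨ cong (_+ N n (suc k) b) (trans (N-rec n k (suc b)) (cong (λ m → Σ< m Y + (N n (suc k) (suc b) + N n k (suc b))) (m≤n⇒m⊓n≡m b<k))) ⟩
      Σ< (suc b) Y + (N n (suc k) (suc b) + N n k (suc b)) + N n (suc k) b
    ≡⟨ cong (λ x → x + (N n (suc k) (suc b) + N n k (suc b)) + N n (suc k) b) (Σ<-last b Y) ⟩
      Σ< b Y + Y b + (N n (suc k) (suc b) + N n k (suc b)) + N n (suc k) b
    ≡⟨ rearrange (Σ< b Y) (N n (suc k) (suc b)) (N n k b) (N n k (suc b)) (N n (suc k) b) ⟩
      Σ< b Y + (N n (suc k) b + N n k b) + 2 * N n (suc k) (suc b) + N n k (suc b)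
    ≡⟨ cong (λ x → x + 2 * N n (suc k) (suc b) + N n k (suc b))
         (sym (trans (N-rec n k b) (cong (λ m → Σ< m Y + (N n (suc k) b + N n k b)) (m≤n⇒m⊓n≡m (<⇒≤ b<k))))) ⟩
      N (suc n) (suc k) b + 2 * N n (suc k) (suc b) + N n k (suc b) ∎
    where
    open ≡-Reasoning
    Y = λ c → N n (suc k) (suc c) + N n k c
    rearrange : ∀ S a c d e → S + (a + c) + (a + d) + e ≡ S + (e + c) + 2 * a + d
    rearrange = solve-∀

  -- A n j = [xⁿ] c(x)ʲ for the Catalan series c = 1 + x c², using cʲ⁺¹ = cʲ + x cʲ⁺²
  A : ℕ → ℕ → ℕ
  A zero    j       = 1
  A (suc n) zero    = 0
  A (suc n) (suc j) = A (suc n) j + A n (suc (suc j))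

  -- B n j = [xⁿ] c(x)ʲ/√(1-4x), using √(1-4x) = 1 - 2x c; xB shifts it by one degree
  B : ℕ → ℕ → ℕ
  B zero    j = 1
  B (suc n) j = A (suc n) j + 2 * B n (suc j)

  xB : ℕ → ℕ → ℕ
  xB zero    j = 0
  xB (suc n) j = B n j

  A-one : ∀ d → A 1 d ≡ d
  A-one zero    = refl
  A-one (suc d) = trans (cong (_+ 1) (A-one d)) (+-comm d 1)

  A+B≡2B : ∀ n j → A n (2 + j) + B n (2 + j) ≡ 2 * B n (suc j)
  A+B≡2B zero    j = refl
  A+B≡2B (suc n) j = trans (rearrange (A (suc n) (suc j)) (A n (3 + j)) (B n (3 + j)))
                           (cong (λ x → 2 * (A (suc n) (suc j) + x)) (A+B≡2B n (suc j)))
    where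
    rearrange : ∀ a c e → (a + c) + ((a + c) + 2 * e) ≡ 2 * (a + (c + e))
    rearrange = solve-∀

  B-suc : ∀ n j → B n (suc j) ≡ B n j + xB n (2 + j)
  B-suc zero    j = refl
  B-suc (suc n) j = trans (rearrange (A (suc n) j) (A n (2 + j)) (B n (2 + j)))
                          (cong (λ x → A (suc n) j + x + B n (2 + j)) (A+B≡2B n j))
    where
    rearrange : ∀ a c e → a + c + 2 * e ≡ a + (c + e) + e
    rearrange = solve-∀

  B≡A+xB : ∀ n j → B n j ≡ A n (suc j) + xB n (2 + j)
  B≡A+xB zero    j = refl
  B≡A+xB (suc n) j = +-cancelʳ-≡ (B n (2 + j)) _ _ (begin
      B (suc n) j + B n (2 + j)                   ≡⟨ B-suc (suc n) j ⟨
      A (suc n) (suc j) + 2 * B n (2 + j)         ≡⟨ rearrange (A (suc n) (suc j)) (B n (2 + j)) ⟩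
      A (suc n) (suc j) + B n (2 + j) + B n (2 + j) ∎)
    where
    open ≡-Reasoning
    rearrange : ∀ a e → a + 2 * e ≡ a + e + e
    rearrange = solve-∀

  N-perm₀ : ∀ m → N m m 0 ≡ 1
  N-perm₀ zero    = refl
  N-perm₀ (suc m) = trans (N-rec m m 0) (cong₂ _+_ (N-vanish m (suc m) 0 ≤-refl) (N-perm₀ m))

  N-perm : ∀ b e → N (b + e) (b + e) b ≡ A b (suc e)
  N-perm zero    e       = N-perm₀ e
  N-perm (suc b) zero    = begin
      N (suc b + 0) (suc b + 0) (suc b) ≡⟨ cong (λ m → N m m (suc b)) (+-identityʳ (suc b)) ⟩
      N (suc b) (suc b) (suc b)         ≡⟨ N-saturated₂ (suc b) (suc b) (suc b) b (n≤1+n (suc b)) ≤-refl ⟩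
      N (suc b) (suc b) b               ≡⟨ cong (λ m → N m m b) (+-comm 1 b) ⟩
      N (b + 1) (b + 1) b               ≡⟨ N-perm b 1 ⟩
      A b 2                             ∎
    where open ≡-Reasoning
  N-perm (suc b) (suc e) = begin
      N (suc M) (suc M) (suc b)
    ≡⟨ drop-vanishing {y = N (suc M) (suc M) b} {z = N M M (suc b)} (N-rec-step M M b b<M) (N-vanish M (suc M) b ≤-refl) (N-vanish M (suc M) (suc b) ≤-refl) ⟩
      N (suc M) (suc M) b + N M M (suc b)
    ≡⟨ cong₂ _+_
         (trans (cong (λ m → N m m b) (sym (+-suc b (suc e)))) (N-perm b (suc (suc e))))
         (trans (cong (λ m → N m m (suc b)) (+-suc b e)) (N-perm (suc b) e)) ⟩
      A b (3 + e) + A (suc b) (suc e)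
    ≡⟨ +-comm (A b (3 + e)) (A (suc b) (suc e)) ⟩
      A (suc b) (2 + e) ∎
    where
    open ≡-Reasoning
    M = b + suc e
    b<M : suc b ≤ M
    b<M = subst (suc b ≤_) (sym (+-suc b e)) (s≤s (m≤m+n b e))
    drop-vanishing : ∀ {x y z u v} → x + u ≡ y + 2 * v + z → u ≡ 0 → v ≡ 0 → x ≡ y + z
    drop-vanishing {x} {y} eq refl refl = trans (sym (+-identityʳ x)) (trans eq (cong (_+ _) (+-identityʳ y)))

  -- N (1 + b + d) (b + d) b = near⁺ b d − near⁻ b d; the parts are kept apart to avoid truncated subtraction
  near⁺ near⁻ : ℕ → ℕ → ℕ
  near⁺ b d = d * (B b d + B b (suc d)) + xB b (2 + d) + xB b (3 + d) + A b (suc d)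
  near⁻ b d = A (suc b) d + A b (2 + d)

  N-near₀ : ∀ d → N (suc d) d 0 ≡ d
  N-near₀ zero    = refl
  N-near₀ (suc d) = trans (N-rec (suc d) d 0) (cong₂ _+_ (N-perm₀ (suc d)) (N-near₀ d))

  near-closed₀ : ∀ d → d + near⁻ 0 d ≡ near⁺ 0 d
  near-closed₀ d = trans (cong (λ x → d + (x + 1)) (A-one d)) (polynomial d)
    where
    polynomial : ∀ d → d + (d + 1) ≡ d * (1 + 1) + 0 + 0 + 1
    polynomial = solve-∀

  near-closed-diag : ∀ b → near⁺ (suc b) 0 + near⁻ b 1 ≡ near⁺ b 1 + near⁻ (suc b) 0
  near-closed-diag b rewrite B-suc b 2 | B-suc b 1 = polynomial (B b 1) (xB b 3) (xB b 4) (A b 2) (A b 3)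
    where
    polynomial : ∀ u₁ p₃ p₄ a₂ a₃ → 0 + (u₁ + p₃) + (u₁ + p₃ + p₄) + (0 + a₂) + ((0 + a₂) + a₃)
                                   ≡ 1 * (u₁ + (u₁ + p₃)) + p₃ + p₄ + a₂ + (0 + ((0 + a₂) + a₃))
    polynomial = solve-∀

  -- The closed form satisfies N-rec-step.  Coefficients at level b + 1 unfold definitionally;
  -- those at level b are tied together by B≡A+xB and B-suc.
  near-closed-step : ∀ b d →
    near⁺ (suc b) (suc d) + near⁻ b (2 + d) + near⁻ (suc b) d + A b (3 + d)
      ≡ near⁻ (suc b) (suc d) + near⁺ b (2 + d) + near⁺ (suc b) d + 2 * A (suc b) (2 + d)
  near-closed-step b d = identity d (A (suc b) (suc d)) (A b (3 + d)) (A b (4 + d)) (A (2 + b) d) (xB b (4 + d)) (xB b (5 + d))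
    (B (suc b) d) (B b (2 + d)) (B b (3 + d)) (B b (4 + d))
    (B≡A+xB (suc b) d) (B≡A+xB b (2 + d)) (B-suc b (2 + d)) (B-suc b (3 + d))
    where
    identity : ∀ d α a₃ a₄ γ p₄ p₅ X u₂ u₃ u₄ → X ≡ α + u₂ → u₂ ≡ a₃ + p₄ → u₃ ≡ u₂ + p₄ → u₄ ≡ u₃ + p₅ →
      (suc d * ((α + 2 * u₂) + ((α + a₃) + 2 * u₃)) + u₃ + u₄ + (α + a₃)) + ((α + a₃) + a₄) + (γ + (α + a₃)) + a₃
        ≡ ((γ + (α + a₃)) + ((α + a₃) + a₄)) + (suc (suc d) * (u₂ + u₃) + p₄ + p₅ + a₃)
          + (d * (X + (α + 2 * u₂)) + u₂ + u₃ + α) + 2 * (α + a₃)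
    identity d α a₃ a₄ γ p₄ p₅ _ _ _ _ refl refl refl refl = polynomial d α a₃ a₄ γ p₄ p₅
      where
      polynomial : ∀ d α a₃ a₄ γ p₄ p₅ → let u₂ = a₃ + p₄; u₃ = u₂ + p₄; u₄ = u₃ + p₅; X = α + u₂ in
        (suc d * ((α + 2 * u₂) + ((α + a₃) + 2 * u₃)) + u₃ + u₄ + (α + a₃)) + ((α + a₃) + a₄) + (γ + (α + a₃)) + a₃
          ≡ ((γ + (α + a₃)) + ((α + a₃) + a₄)) + (suc (suc d) * (u₂ + u₃) + p₄ + p₅ + a₃)
            + (d * (X + (α + 2 * u₂)) + u₂ + u₃ + α) + 2 * (α + a₃)
      polynomial = solve-∀

  N-near : ∀ b d → N (suc (b + d)) (b + d) b + near⁻ b d ≡ near⁺ b d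
  N-near zero    d    = trans (cong (_+ near⁻ 0 d) (N-near₀ d)) (near-closed₀ d)
  N-near (suc b) zero = +-cancelʳ-≡ (near⁻ b 1) _ _ (begin
      q + near⁻ (suc b) 0 + near⁻ b 1           ≡⟨ swap q (near⁻ (suc b) 0) (near⁻ b 1) ⟩
      q + near⁻ b 1 + near⁻ (suc b) 0           ≡⟨ cong (λ x → x + near⁻ b 1 + near⁻ (suc b) 0) q≡ ⟩
      N (suc (b + 1)) (b + 1) b + near⁻ b 1 + near⁻ (suc b) 0 ≡⟨ cong (_+ near⁻ (suc b) 0) (N-near b 1) ⟩
      near⁺ b 1 + near⁻ (suc b) 0               ≡⟨ near-closed-diag b ⟨
      near⁺ (suc b) 0 + near⁻ b 1               ∎)
    where
    open ≡-Reasoning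
    q = N (suc (suc b + 0)) (suc b + 0) (suc b)
    q≡ : q ≡ N (suc (b + 1)) (b + 1) b
    q≡ = begin
      q                             ≡⟨ cong (λ m → N (suc m) m (suc b)) (+-identityʳ (suc b)) ⟩
      N (suc (suc b)) (suc b) (suc b) ≡⟨ N-saturated₂ (suc (suc b)) (suc b) (suc b) b (n≤1+n (suc b)) ≤-refl ⟩
      N (suc (suc b)) (suc b) b     ≡⟨ cong (λ m → N (suc m) m b) (+-comm 1 b) ⟩
      N (suc (b + 1)) (b + 1) b     ∎
    swap : ∀ x y z → x + y + z ≡ x + z + y
    swap = solve-∀
  N-near (suc b) (suc d) = +-cancelʳ-≡ (near⁻ b (2 + d) + near⁻ (suc b) d + a₃) _ _ (begin
      T + near⁻ (suc b) (suc d) + (near⁻ b (2 + d) + near⁻ (suc b) d + a₃)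
    ≡⟨ rearrange₁ T (near⁻ (suc b) (suc d)) (near⁻ b (2 + d)) (near⁻ (suc b) d) a₃ ⟩
      T + a₃ + near⁻ (suc b) (suc d) + near⁻ b (2 + d) + near⁻ (suc b) d
    ≡⟨ cong (λ x → x + near⁻ (suc b) (suc d) + near⁻ b (2 + d) + near⁻ (suc b) d) recurrence ⟩
      Q₁ + 2 * A (suc b) (2 + d) + Q₂ + near⁻ (suc b) (suc d) + near⁻ b (2 + d) + near⁻ (suc b) d
    ≡⟨ rearrange₂ Q₁ (A (suc b) (2 + d)) Q₂ (near⁻ (suc b) (suc d)) (near⁻ b (2 + d)) (near⁻ (suc b) d) ⟩
      near⁻ (suc b) (suc d) + (Q₁ + near⁻ b (2 + d)) + (Q₂ + near⁻ (suc b) d) + 2 * A (suc b) (2 + d)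
    ≡⟨ cong₂ (λ x y → near⁻ (suc b) (suc d) + x + y + 2 * A (suc b) (2 + d)) (N-near b (2 + d)) (N-near (suc b) d) ⟩
      near⁻ (suc b) (suc d) + near⁺ b (2 + d) + near⁺ (suc b) d + 2 * A (suc b) (2 + d)
    ≡⟨ near-closed-step b d ⟨
      near⁺ (suc b) (suc d) + near⁻ b (2 + d) + near⁻ (suc b) d + a₃
    ≡⟨ +-assoc (near⁺ (suc b) (suc d) + near⁻ b (2 + d)) (near⁻ (suc b) d) a₃ ⟩
      near⁺ (suc b) (suc d) + near⁻ b (2 + d) + (near⁻ (suc b) d + a₃)
    ≡⟨ +-assoc (near⁺ (suc b) (suc d)) (near⁻ b (2 + d)) (near⁻ (suc b) d + a₃) ⟩
      near⁺ (suc b) (suc d) + (near⁻ b (2 + d) + (near⁻ (suc b) d + a₃))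
    ≡⟨ cong (near⁺ (suc b) (suc d) +_) (sym (+-assoc (near⁻ b (2 + d)) (near⁻ (suc b) d) a₃)) ⟩
      near⁺ (suc b) (suc d) + (near⁻ b (2 + d) + near⁻ (suc b) d + a₃) ∎)
    where
    open ≡-Reasoning
    M  = b + suc d
    T  = N (suc (suc M)) (suc M) (suc b)
    a₃ = A b (3 + d)
    Q₁ = N (suc (b + (2 + d))) (b + (2 + d)) b
    Q₂ = N (suc (suc b + d)) (suc b + d) (suc b)
    recurrence : T + a₃ ≡ Q₁ + 2 * A (suc b) (2 + d) + Q₂
    recurrence = begin
        T + a₃
      ≡⟨ cong (T +_) (trans (cong (λ m → N m m b) (sym (+-suc b (suc d)))) (N-perm b (2 + d))) ⟨
        T + N (suc M) (suc M) b
      ≡⟨ N-rec-step (suc M) M b (subst (suc b ≤_) (sym (+-suc b d)) (s≤s (m≤m+n b d))) ⟩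
        N (suc (suc M)) (suc M) b + 2 * N (suc M) (suc M) (suc b) + N (suc M) M (suc b)
      ≡⟨ cong (λ y → N (suc (suc M)) (suc M) b + 2 * y + N (suc M) M (suc b)) (N-perm (suc b) (suc d)) ⟩
        N (suc (suc M)) (suc M) b + 2 * A (suc b) (2 + d) + N (suc M) M (suc b)
      ≡⟨ cong₂ (λ x z → x + 2 * A (suc b) (2 + d) + z) (cong (λ m → N (suc m) m b) (sym (+-suc b (suc d))))
               (cong (λ m → N (suc m) m (suc b)) (+-suc b d)) ⟩
        Q₁ + 2 * A (suc b) (2 + d) + Q₂ ∎
    rearrange₁ : ∀ t m m′ m″ a → t + m + (m′ + m″ + a) ≡ t + a + m + m′ + m″
    rearrange₁ = solve-∀
    rearrange₂ : ∀ q a q′ m m′ m″ → q + 2 * a + q′ + m + m′ + m″ ≡ m + (q + m′) + (q′ + m″) + 2 * a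
    rearrange₂ = solve-∀

open WordCounting using (A; B; xB; N; op123≡N; N-near; near⁺; near⁻)
open import Data.Nat as ℕ using (ℕ; zero; suc; _∸_; s≤s)
import Data.Nat.Properties as ℕ
open import Data.Fin using (toℕ)
open import Data.Fin.Properties using (toℕ<n)
open import Data.Integer using (ℤ; +_; -_; _+_; _-_; _*_)
import Data.Integer.Properties as ℤ
open import Data.Integer.Tactic.RingSolver using (solve-∀)
open import Data.List using (map; foldr; applyUpTo)
open import Data.Product using (_,_)
open import Data.Nat.Induction using (<-rec)
open import Relation.Nullary using (yes; no; contradiction)
open import Algebra.Properties.CommutativeMonoid.Sum ℤ.+-0-commutativeMonoid
  using (sum; sum-cong-≗; ∑-distrib-+; sum-replicate-zero)
open import Algebra.Properties.Semiring.Sum ℤ.+-*-semiring using (*-distribˡ-sum)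

Σ< : ℕ → (ℕ → ℤ) → ℤ
Σ< m f = sum {m} (λ i → f (toℕ i))

Σ<-last : ∀ m f → Σ< (suc m) f ≡ Σ< m f + f m
Σ<-last zero    f = trans (ℤ.+-identityʳ (f 0)) (sym (ℤ.+-identityˡ (f 0)))
Σ<-last (suc m) f = trans (cong (_+_ (f 0)) (Σ<-last m (λ i → f (suc i)))) (sym (ℤ.+-assoc (f 0) _ _))

Σ<-cong : ∀ m {f g : ℕ → ℤ} → (∀ i → i ℕ.< m → f i ≡ g i) → Σ< m f ≡ Σ< m g
Σ<-cong m eq = sum-cong-≗ (λ i → eq (toℕ i) (toℕ<n i))

⊛-Σ< : ∀ f g n → (f ⊛ g) n ≡ Σ< (suc n) (λ i → f i * g (n ∸ i))
⊛-Σ< f g n = foldr-applyUpTo (suc n) (λ i → i) (λ i → f i * g (n ∸ i))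
  where
  foldr-applyUpTo : ∀ m (h : ℕ → ℕ) (F : ℕ → ℤ) → foldr _+_ (+ 0) (map F (applyUpTo h m)) ≡ Σ< m (λ i → F (h i))
  foldr-applyUpTo zero    h F = refl
  foldr-applyUpTo (suc m) h F = cong (_+_ (F (h 0))) (foldr-applyUpTo m (λ i → h (suc i)) F)

⊛-cong : ∀ {f f′ g g′ : PS} → (∀ i → f i ≡ f′ i) → (∀ i → g i ≡ g′ i) → ∀ n → (f ⊛ g) n ≡ (f′ ⊛ g′) n
⊛-cong {f} {f′} {g} {g′} f≗f′ g≗g′ n = begin
    (f ⊛ g) n                              ≡⟨ ⊛-Σ< f g n ⟩
    Σ< (suc n) (λ i → f i * g (n ∸ i))     ≡⟨ Σ<-cong (suc n) (λ i _ → cong₂ _*_ (f≗f′ i) (g≗g′ (n ∸ i))) ⟩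
    Σ< (suc n) (λ i → f′ i * g′ (n ∸ i))   ≡⟨ ⊛-Σ< f′ g′ n ⟨
    (f′ ⊛ g′) n                            ∎
  where open ≡-Reasoning

⊛-congˡ : ∀ {f f′} g → (∀ i → f i ≡ f′ i) → ∀ n → (f ⊛ g) n ≡ (f′ ⊛ g) n
⊛-congˡ {f} {f′} g f≗f′ = ⊛-cong {f} {f′} {g} {g} f≗f′ (λ _ → refl)

⊛-congʳ : ∀ f {g g′} → (∀ i → g i ≡ g′ i) → ∀ n → (f ⊛ g) n ≡ (f ⊛ g′) n
⊛-congʳ f {g} {g′} g≗g′ = ⊛-cong {f} {f} {g} {g′} (λ _ → refl) g≗g′

⊛-head : ∀ f g m → (f ⊛ g) (suc m) ≡ f 0 * g (suc m) + ((λ i → f (suc i)) ⊛ g) m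
⊛-head f g m = trans (⊛-Σ< f g (suc m)) (cong (_+_ (f 0 * g (suc m))) (sym (⊛-Σ< (λ i → f (suc i)) g m)))

⊛-last : ∀ f g m → (f ⊛ g) (suc m) ≡ (f ⊛ (λ i → g (suc i))) m + f (suc m) * g 0
⊛-last f g m = begin
    (f ⊛ g) (suc m)
  ≡⟨ trans (⊛-Σ< f g (suc m)) (Σ<-last (suc m) (λ i → f i * g (suc m ∸ i))) ⟩
    Σ< (suc m) (λ i → f i * g (suc m ∸ i)) + f (suc m) * g (suc m ∸ suc m)
  ≡⟨ cong₂ (λ x y → x + f (suc m) * g y)
       (Σ<-cong (suc m) (λ i i≤m → cong (λ j → f i * g j) (ℕ.+-∸-assoc 1 (ℕ.≤-pred i≤m))))
       (ℕ.n∸n≡0 m) ⟩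
    Σ< (suc m) (λ i → f i * g (suc (m ∸ i))) + f (suc m) * g 0
  ≡⟨ cong (_+ f (suc m) * g 0) (sym (⊛-Σ< f (λ i → g (suc i)) m)) ⟩
    (f ⊛ (λ i → g (suc i))) m + f (suc m) * g 0 ∎
  where open ≡-Reasoning

⊛-shiftˡ : ∀ f g m → f 0 ≡ + 0 → (f ⊛ g) (suc m) ≡ ((λ i → f (suc i)) ⊛ g) m
⊛-shiftˡ f g m f0≡0 = trans (⊛-head f g m)
  (trans (cong (λ x → x * g (suc m) + ((λ i → f (suc i)) ⊛ g) m) f0≡0) (ℤ.+-identityˡ _))

⊛-shiftʳ : ∀ f g m → g 0 ≡ + 0 → (f ⊛ g) (suc m) ≡ (f ⊛ (λ i → g (suc i))) m
⊛-shiftʳ f g m g0≡0 = trans (⊛-last f g m) (trans (cong (λ x → (f ⊛ (λ i → g (suc i))) m + f (suc m) * x) g0≡0)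
  (trans (cong (_+_ ((f ⊛ (λ i → g (suc i))) m)) (ℤ.*-zeroʳ (f (suc m)))) (ℤ.+-identityʳ _)))

⊛-⊕ʳ : ∀ f g h n → (f ⊛ (g ⊕ h)) n ≡ (f ⊛ g) n + (f ⊛ h) n
⊛-⊕ʳ f g h n = begin
    (f ⊛ (g ⊕ h)) n
  ≡⟨ ⊛-Σ< f (g ⊕ h) n ⟩
    Σ< (suc n) (λ i → f i * (g (n ∸ i) + h (n ∸ i)))
  ≡⟨ Σ<-cong (suc n) (λ i _ → ℤ.*-distribˡ-+ (f i) (g (n ∸ i)) (h (n ∸ i))) ⟩
    Σ< (suc n) (λ i → f i * g (n ∸ i) + f i * h (n ∸ i))
  ≡⟨ ∑-distrib-+ {suc n} (λ i → f (toℕ i) * g (n ∸ toℕ i)) (λ i → f (toℕ i) * h (n ∸ toℕ i)) ⟩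
    Σ< (suc n) (λ i → f i * g (n ∸ i)) + Σ< (suc n) (λ i → f i * h (n ∸ i))
  ≡⟨ cong₂ _+_ (⊛-Σ< f g n) (⊛-Σ< f h n) ⟨
    (f ⊛ g) n + (f ⊛ h) n ∎
  where open ≡-Reasoning

⊛-scaleˡ : ∀ c f g n → ((λ i → c * f i) ⊛ g) n ≡ c * (f ⊛ g) n
⊛-scaleˡ c f g n = begin
    ((λ i → c * f i) ⊛ g) n
  ≡⟨ ⊛-Σ< (λ i → c * f i) g n ⟩
    Σ< (suc n) (λ i → c * f i * g (n ∸ i))
  ≡⟨ Σ<-cong (suc n) (λ i _ → ℤ.*-assoc c (f i) (g (n ∸ i))) ⟩
    Σ< (suc n) (λ i → c * (f i * g (n ∸ i)))
  ≡⟨ *-distribˡ-sum {suc n} c (λ i → f (toℕ i) * g (n ∸ toℕ i)) ⟨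
    c * Σ< (suc n) (λ i → f i * g (n ∸ i))
  ≡⟨ cong (c *_) (⊛-Σ< f g n) ⟨
    c * (f ⊛ g) n ∎
  where open ≡-Reasoning

⊛-scaleʳ : ∀ c f g n → (f ⊛ (λ i → c * g i)) n ≡ c * (f ⊛ g) n
⊛-scaleʳ c f g n = begin
    (f ⊛ (λ i → c * g i)) n
  ≡⟨ ⊛-Σ< f (λ i → c * g i) n ⟩
    Σ< (suc n) (λ i → f i * (c * g (n ∸ i)))
  ≡⟨ Σ<-cong (suc n) (λ i _ → swap (f i) c (g (n ∸ i))) ⟩
    Σ< (suc n) (λ i → c * (f i * g (n ∸ i)))
  ≡⟨ *-distribˡ-sum {suc n} c (λ i → f (toℕ i) * g (n ∸ toℕ i)) ⟨
    c * Σ< (suc n) (λ i → f i * g (n ∸ i))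
  ≡⟨ cong (c *_) (⊛-Σ< f g n) ⟨
    c * (f ⊛ g) n ∎
  where
  open ≡-Reasoning
  swap : ∀ a c b → a * (c * b) ≡ c * (a * b)
  swap = solve-∀

⊛-⊖ʳ : ∀ f g h n → (f ⊛ (g ⊖ h)) n ≡ (f ⊛ g) n - (f ⊛ h) n
⊛-⊖ʳ f g h n = begin
    (f ⊛ (g ⊖ h)) n                              ≡⟨ ⊛-congʳ f (λ i → neg (g i) (h i)) n ⟩
    (f ⊛ (g ⊕ (λ i → - + 1 * h i))) n            ≡⟨ ⊛-⊕ʳ f g (λ i → - + 1 * h i) n ⟩
    (f ⊛ g) n + (f ⊛ (λ i → - + 1 * h i)) n      ≡⟨ cong (_+_ ((f ⊛ g) n)) (⊛-scaleʳ (- + 1) f h n) ⟩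
    (f ⊛ g) n + - + 1 * (f ⊛ h) n                ≡⟨ neg ((f ⊛ g) n) ((f ⊛ h) n) ⟨
    (f ⊛ g) n - (f ⊛ h) n                        ∎
  where
  open ≡-Reasoning
  neg : ∀ x y → x - y ≡ x + - + 1 * y
  neg = solve-∀

mono-≢ : ∀ c m n → m ≢ n → mono c m n ≡ + 0
mono-≢ c m n m≢n with m ℕ.≟ n
... | yes m≡n = contradiction m≡n m≢n
... | no  _   = refl

mono-diag : ∀ c n → mono c n n ≡ c
mono-diag c n with n ℕ.≟ n
... | yes _   = refl
... | no  n≢n = contradiction refl n≢n

mono-suc : ∀ c m n → mono c (suc m) (suc n) ≡ mono c m n
mono-suc c m n with m ℕ.≟ n
... | yes refl = mono-diag c (suc m)
... | no  m≢n  = mono-≢ c (suc m) (suc n) (λ eq → m≢n (ℕ.suc-injective eq))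

mono₀-⊛ : ∀ c g n → (mono c 0 ⊛ g) n ≡ c * g n
mono₀-⊛ c g n = trans (⊛-Σ< (mono c 0) g n)
  (trans (cong (_+_ (c * g n)) (sum-replicate-zero n)) (ℤ.+-identityʳ (c * g n)))

mono₁-⊛ : ∀ c g n → (mono c 1 ⊛ g) (suc n) ≡ c * g n
mono₁-⊛ c g n = trans (⊛-shiftˡ (mono c 1) g n refl)
  (trans (⊛-congˡ g (mono-suc c 0) n) (mono₀-⊛ c g n))

Aˢ Bˢ xBˢ : ℕ → PS
Aˢ  j n = + A n j
Bˢ  j n = + B n j
xBˢ j n = + xB n j

Bˢ-suc : ∀ j i → Bˢ j (suc i) ≡ Aˢ j (suc i) + + 2 * Bˢ (suc j) i
Bˢ-suc j i = cong (_+_ (Aˢ j (suc i))) (ℤ.pos-* 2 (B i (suc j)))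

Aˢ₁-⊛-Aˢ : ∀ j m → (Aˢ 1 ⊛ Aˢ j) m ≡ Aˢ (suc j) m
Aˢ₁-⊛-Aˢ j       zero    = refl
Aˢ₁-⊛-Aˢ zero    (suc m) = begin
    (Aˢ 1 ⊛ Aˢ 0) (suc m)                        ≡⟨ ⊛-last (Aˢ 1) (Aˢ 0) m ⟩
    (Aˢ 1 ⊛ (λ _ → + 0)) m + Aˢ 1 (suc m) * + 1  ≡⟨ cong₂ _+_ (⊛-scaleʳ (+ 0) (Aˢ 1) (λ _ → + 0) m) (ℤ.*-identityʳ (Aˢ 1 (suc m))) ⟩
    + 0 * (Aˢ 1 ⊛ (λ _ → + 0)) m + Aˢ 1 (suc m)  ≡⟨ ℤ.+-identityˡ (Aˢ 1 (suc m)) ⟩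
    Aˢ 1 (suc m)                                 ∎
  where open ≡-Reasoning
Aˢ₁-⊛-Aˢ (suc j) (suc m) = begin
    (Aˢ 1 ⊛ Aˢ (suc j)) (suc m)
  ≡⟨ ⊛-last (Aˢ 1) (Aˢ (suc j)) m ⟩
    (Aˢ 1 ⊛ (λ i → Aˢ (suc j) (suc i))) m + Aˢ 1 (suc m) * + 1
  ≡⟨ cong (_+ Aˢ 1 (suc m) * + 1) (⊛-⊕ʳ (Aˢ 1) (λ i → Aˢ j (suc i)) (Aˢ (2 ℕ.+ j)) m) ⟩
    (Aˢ 1 ⊛ (λ i → Aˢ j (suc i))) m + (Aˢ 1 ⊛ Aˢ (2 ℕ.+ j)) m + Aˢ 1 (suc m) * + 1
  ≡⟨ swap ((Aˢ 1 ⊛ (λ i → Aˢ j (suc i))) m) ((Aˢ 1 ⊛ Aˢ (2 ℕ.+ j)) m) (Aˢ 1 (suc m) * + 1) ⟩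
    (Aˢ 1 ⊛ (λ i → Aˢ j (suc i))) m + Aˢ 1 (suc m) * Aˢ j 0 + (Aˢ 1 ⊛ Aˢ (2 ℕ.+ j)) m
  ≡⟨ cong₂ _+_ (trans (sym (⊛-last (Aˢ 1) (Aˢ j) m)) (Aˢ₁-⊛-Aˢ j (suc m))) (Aˢ₁-⊛-Aˢ (2 ℕ.+ j) m) ⟩
    Aˢ (suc (suc j)) (suc m) ∎
  where
  open ≡-Reasoning
  swap : ∀ x y z → x + y + z ≡ x + z + y
  swap = solve-∀

Aˢ₁-⊛-Bˢ : ∀ j m → (Aˢ 1 ⊛ Bˢ j) m ≡ Bˢ (suc j) m
Aˢ₁-⊛-Bˢ j zero    = refl
Aˢ₁-⊛-Bˢ j (suc m) = begin
    (Aˢ 1 ⊛ Bˢ j) (suc m)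
  ≡⟨ ⊛-last (Aˢ 1) (Bˢ j) m ⟩
    (Aˢ 1 ⊛ (λ i → Bˢ j (suc i))) m + Aˢ 1 (suc m) * + 1
  ≡⟨ cong (_+ Aˢ 1 (suc m) * + 1) (trans (⊛-congʳ (Aˢ 1) (Bˢ-suc j) m)
       (trans (⊛-⊕ʳ (Aˢ 1) (λ i → Aˢ j (suc i)) (λ i → + 2 * Bˢ (suc j) i) m)
              (cong (_+_ ((Aˢ 1 ⊛ (λ i → Aˢ j (suc i))) m)) (⊛-scaleʳ (+ 2) (Aˢ 1) (Bˢ (suc j)) m)))) ⟩
    (Aˢ 1 ⊛ (λ i → Aˢ j (suc i))) m + + 2 * (Aˢ 1 ⊛ Bˢ (suc j)) m + Aˢ 1 (suc m) * + 1
  ≡⟨ swap ((Aˢ 1 ⊛ (λ i → Aˢ j (suc i))) m) (+ 2 * (Aˢ 1 ⊛ Bˢ (suc j)) m) (Aˢ 1 (suc m) * + 1) ⟩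
    (Aˢ 1 ⊛ (λ i → Aˢ j (suc i))) m + Aˢ 1 (suc m) * Aˢ j 0 + + 2 * (Aˢ 1 ⊛ Bˢ (suc j)) m
  ≡⟨ cong₂ (λ x y → x + + 2 * y) (trans (sym (⊛-last (Aˢ 1) (Aˢ j) m)) (Aˢ₁-⊛-Aˢ j (suc m))) (Aˢ₁-⊛-Bˢ (suc j) m) ⟩
    Aˢ (suc j) (suc m) + + 2 * Bˢ (2 ℕ.+ j) m
  ≡⟨ Bˢ-suc (suc j) m ⟨
    Bˢ (suc j) (suc m) ∎
  where
  open ≡-Reasoning
  swap : ∀ x y z → x + y + z ≡ x + z + y
  swap = solve-∀

-- √(1-4x) = 1 - 2x c(x)
sqrt1-4x : PS
sqrt1-4x zero    = + 1
sqrt1-4x (suc n) = - (+ 2 * Aˢ 1 n)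

sqrt-⊛ : ∀ f m → (sqrt1-4x ⊛ f) (suc m) ≡ f (suc m) - + 2 * (Aˢ 1 ⊛ f) m
sqrt-⊛ f m = begin
    (sqrt1-4x ⊛ f) (suc m)                              ≡⟨ ⊛-head sqrt1-4x f m ⟩
    + 1 * f (suc m) + ((λ i → - (+ 2 * Aˢ 1 i)) ⊛ f) m  ≡⟨ cong (_+_ (+ 1 * f (suc m)))
         (trans (⊛-congˡ f (λ i → ℤ.neg-distribˡ-* (+ 2) (Aˢ 1 i)) m) (⊛-scaleˡ (- + 2) (Aˢ 1) f m)) ⟩
    + 1 * f (suc m) + - + 2 * (Aˢ 1 ⊛ f) m              ≡⟨ normalise (f (suc m)) ((Aˢ 1 ⊛ f) m) ⟩
    f (suc m) - + 2 * (Aˢ 1 ⊛ f) m                      ∎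
  where
  open ≡-Reasoning
  normalise : ∀ x y → + 1 * x + - + 2 * y ≡ x - + 2 * y
  normalise = solve-∀

sqrt-⊛-Aˢ : ∀ j m → (sqrt1-4x ⊛ Aˢ j) (suc m) ≡ Aˢ j (suc m) - + 2 * Aˢ (suc j) m
sqrt-⊛-Aˢ j m = trans (sqrt-⊛ (Aˢ j) m) (cong (λ x → Aˢ j (suc m) - + 2 * x) (Aˢ₁-⊛-Aˢ j m))

sqrt-⊛-Bˢ : ∀ j m → (sqrt1-4x ⊛ Bˢ j) m ≡ Aˢ j m
sqrt-⊛-Bˢ j zero    = refl
sqrt-⊛-Bˢ j (suc m) = begin
    (sqrt1-4x ⊛ Bˢ j) (suc m)                              ≡⟨ sqrt-⊛ (Bˢ j) m ⟩
    Bˢ j (suc m) - + 2 * (Aˢ 1 ⊛ Bˢ j) m                   ≡⟨ cong₂ (λ x y → x - + 2 * y) (Bˢ-suc j m) (Aˢ₁-⊛-Bˢ j m) ⟩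
    Aˢ j (suc m) + + 2 * Bˢ (suc j) m - + 2 * Bˢ (suc j) m ≡⟨ cancel (Aˢ j (suc m)) (Bˢ (suc j) m) ⟩
    Aˢ j (suc m)                                           ∎
  where
  open ≡-Reasoning
  cancel : ∀ x y → x + + 2 * y - + 2 * y ≡ x
  cancel = solve-∀

sqrt-⊛-xBˢ : ∀ j m → (sqrt1-4x ⊛ xBˢ j) (suc m) ≡ Aˢ j m
sqrt-⊛-xBˢ j m = trans (⊛-shiftʳ sqrt1-4x (xBˢ j) m refl) (sqrt-⊛-Bˢ j m)

sqrt1-4x² : ∀ n → (sqrt1-4x ⊛ sqrt1-4x) n ≡ (mono (+ 1) 0 ⊖ mono (+ 4) 1) n
sqrt1-4x² zero          = refl
sqrt1-4x² (suc zero)    = refl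
sqrt1-4x² (suc (suc m)) = begin
    (sqrt1-4x ⊛ sqrt1-4x) (suc (suc m))
  ≡⟨ sqrt-⊛ sqrt1-4x (suc m) ⟩
    sqrt1-4x (2 ℕ.+ m) - + 2 * (Aˢ 1 ⊛ sqrt1-4x) (suc m)
  ≡⟨ cong (λ x → sqrt1-4x (2 ℕ.+ m) - + 2 * x) (⊛-last (Aˢ 1) sqrt1-4x m) ⟩
    sqrt1-4x (2 ℕ.+ m) - + 2 * ((Aˢ 1 ⊛ (λ i → - (+ 2 * Aˢ 1 i))) m + Aˢ 1 (suc m) * + 1)
  ≡⟨ cong (λ x → sqrt1-4x (2 ℕ.+ m) - + 2 * (x + Aˢ 1 (suc m) * + 1))
       (trans (⊛-congʳ (Aˢ 1) (λ i → ℤ.neg-distribˡ-* (+ 2) (Aˢ 1 i)) m)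
              (trans (⊛-scaleʳ (- + 2) (Aˢ 1) (Aˢ 1) m) (cong (- + 2 *_) (Aˢ₁-⊛-Aˢ 1 m)))) ⟩
    - (+ 2 * Aˢ 2 m) - + 2 * (- + 2 * Aˢ 2 m + Aˢ 2 m * + 1)
  ≡⟨ vanish (Aˢ 2 m) ⟩
    + 0 ∎
  where
  open ≡-Reasoning
  vanish : ∀ a → - (+ 2 * a) - + 2 * (- + 2 * a + a * + 1) ≡ + 0
  vanish = solve-∀

⊛-self : ∀ f m → (f ⊛ f) (suc m) ≡ f 0 * f (suc m) + (Σ< m (λ i → f (suc i) * f (m ∸ i)) + f (suc m) * f 0)
⊛-self f m = trans (⊛-head f f m) (cong (_+_ (f 0 * f (suc m)))
  (trans (⊛-Σ< (λ i → f (suc i)) f m)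
  (trans (Σ<-last m (λ i → f (suc i) * f (m ∸ i)))
         (cong (λ j → Σ< m (λ i → f (suc i) * f (m ∸ i)) + f (suc m) * f j) (ℕ.n∸n≡0 m)))))

-- (S·S)ₘ₊₁ = 2 Sₘ₊₁ + (terms with lower indices) determines S recursively
sqrt-unique : ∀ S → IsSqrt1-4x S → ∀ n → S n ≡ sqrt1-4x n
sqrt-unique S (S0≡1 , S²≡1-4x) = <-rec (λ n → S n ≡ sqrt1-4x n) agree
  where
  s = sqrt1-4x
  cancel-middle : ∀ x y M → + 1 * x + (M + x * + 1) ≡ + 1 * y + (M + y * + 1) → x ≡ y
  cancel-middle x y M eq = ℤ.*-cancelˡ-≡ (+ 2) x y (trans (twice x M) (trans (cong (_- M) eq) (sym (twice y M))))
    where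
    twice : ∀ x M → + 2 * x ≡ + 1 * x + (M + x * + 1) - M
    twice = solve-∀
  agree : ∀ n → (∀ {i} → i ℕ.< n → S i ≡ s i) → S n ≡ s n
  agree zero    _     = S0≡1
  agree (suc m) below = cancel-middle (S (suc m)) (s (suc m)) (Σ< m (λ i → s (suc i) * s (m ∸ i))) (begin
      + 1 * S (suc m) + (Σ< m (λ i → s (suc i) * s (m ∸ i)) + S (suc m) * + 1)
    ≡⟨ cong₂ (λ a M → a * S (suc m) + (M + S (suc m) * a)) (sym S0≡1)
         (Σ<-cong m (λ i i<m → sym (cong₂ _*_ (below (s≤s i<m)) (below (s≤s (ℕ.m∸n≤m m i)))))) ⟩
      S 0 * S (suc m) + (Σ< m (λ i → S (suc i) * S (m ∸ i)) + S (suc m) * S 0)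
    ≡⟨ ⊛-self S m ⟨
      (S ⊛ S) (suc m)
    ≡⟨ trans (S²≡1-4x (suc m)) (sym (sqrt1-4x² (suc m))) ⟩
      (s ⊛ s) (suc m)
    ≡⟨ ⊛-self s m ⟩
      + 1 * s (suc m) + (Σ< m (λ i → s (suc i) * s (m ∸ i)) + s (suc m) * + 1) ∎)
    where open ≡-Reasoning

G/x : PS
G/x = xBˢ 2 ⊕ xBˢ 3 ⊕ Aˢ 1 ⊖ Aˢ 2

G-suc : ∀ n → G (suc n) ≡ G/x n
G-suc n = subtract (trans (cong (λ a → a ℕ.+ near⁻ n 0) count) (N-near n 0))
  where
  count : op123 (suc n) n ≡ N (suc (n ℕ.+ 0)) (n ℕ.+ 0) n
  count = trans (op123≡N (suc n) n n (ℕ.n≤1+n n)) (cong (λ m → N (suc m) m n) (sym (ℕ.+-identityʳ n)))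
  subtract : ∀ {a b c} → a ℕ.+ b ≡ c → + a ≡ + c - + b
  subtract {a} {b} refl = sym (cancel (+ a) (+ b))
    where
    cancel : ∀ x y → x + y - y ≡ x
    cancel = solve-∀

sqrt-⊛-G/x : ∀ t → (sqrt1-4x ⊛ G/x) (suc t) ≡ - Aˢ 2 t + + 2 * Aˢ 3 t
sqrt-⊛-G/x t = begin
    (sqrt1-4x ⊛ G/x) (suc t)
  ≡⟨ ⊛-⊖ʳ s (xBˢ 2 ⊕ xBˢ 3 ⊕ Aˢ 1) (Aˢ 2) (suc t) ⟩
    (s ⊛ (xBˢ 2 ⊕ xBˢ 3 ⊕ Aˢ 1)) (suc t) - (s ⊛ Aˢ 2) (suc t)
  ≡⟨ cong (_- (s ⊛ Aˢ 2) (suc t)) (trans (⊛-⊕ʳ s (xBˢ 2 ⊕ xBˢ 3) (Aˢ 1) (suc t))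
       (cong (_+ (s ⊛ Aˢ 1) (suc t)) (⊛-⊕ʳ s (xBˢ 2) (xBˢ 3) (suc t)))) ⟩
    (s ⊛ xBˢ 2) (suc t) + (s ⊛ xBˢ 3) (suc t) + (s ⊛ Aˢ 1) (suc t) - (s ⊛ Aˢ 2) (suc t)
  ≡⟨ cong₂ _-_ (cong₂ _+_ (cong₂ _+_ (sqrt-⊛-xBˢ 2 t) (sqrt-⊛-xBˢ 3 t)) (sqrt-⊛-Aˢ 1 t)) (sqrt-⊛-Aˢ 2 t) ⟩
    Aˢ 2 t + Aˢ 3 t + (Aˢ 2 t - + 2 * Aˢ 2 t) - ((Aˢ 2 t + Aˢ 3 t) - + 2 * Aˢ 3 t)
  ≡⟨ simplify (Aˢ 2 t) (Aˢ 3 t) ⟩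
    - Aˢ 2 t + + 2 * Aˢ 3 t ∎
  where
  open ≡-Reasoning
  s = sqrt1-4x
  simplify : ∀ a b → a + b + (a - + 2 * a) - ((a + b) - + 2 * b) ≡ - a + + 2 * b
  simplify = solve-∀

⊛-G : ∀ f m → (f ⊛ G) (suc m) ≡ (f ⊛ G/x) m
⊛-G f m = trans (⊛-shiftʳ f G m refl) (⊛-congʳ f G-suc m)

2xS⊛G-suc : ∀ S m → (mono (+ 2) 1 ⊛ S ⊛ G) (suc m) ≡ + 2 * (S ⊛ G) m
2xS⊛G-suc S m = trans (⊛-shiftˡ (mono (+ 2) 1 ⊛ S) G m refl)
  (trans (⊛-congˡ G (mono₁-⊛ (+ 2) S) m) (⊛-scaleˡ (+ 2) S G m))

rhs-suc : ∀ S m → (mono (+ 2) 2 ⊖ mono (+ 7) 1 ⊕ mono (+ 2) 0 ⊕ mono (+ 3) 1 ⊛ S ⊖ mono (+ 2) 0 ⊛ S) (suc m)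
                ≡ mono (+ 2) 2 (suc m) - mono (+ 7) 1 (suc m) + mono (+ 2) 0 (suc m) + + 3 * S m - + 2 * S (suc m)
rhs-suc S m = cong₂ (λ x y → mono (+ 2) 2 (suc m) - mono (+ 7) 1 (suc m) + mono (+ 2) 0 (suc m) + x - y)
  (mono₁-⊛ (+ 3) S m) (mono₀-⊛ (+ 2) S (suc m))

sqrt-⊛-G : ∀ m → + 2 * (sqrt1-4x ⊛ G) m ≡
  mono (+ 2) 2 (suc m) - mono (+ 7) 1 (suc m) + mono (+ 2) 0 (suc m) + + 3 * sqrt1-4x m - + 2 * sqrt1-4x (suc m)
sqrt-⊛-G zero          = refl
sqrt-⊛-G (suc zero)    = refl
sqrt-⊛-G (suc (suc t)) = begin
    + 2 * (sqrt1-4x ⊛ G) (2 ℕ.+ t)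
  ≡⟨ cong (+ 2 *_) (trans (⊛-G sqrt1-4x (suc t)) (sqrt-⊛-G/x t)) ⟩
    + 2 * (- Aˢ 2 t + + 2 * Aˢ 3 t)
  ≡⟨ polynomial (Aˢ 2 t) (Aˢ 3 t) ⟩
    mono (+ 2) 2 (3 ℕ.+ t) - mono (+ 7) 1 (3 ℕ.+ t) + mono (+ 2) 0 (3 ℕ.+ t) + + 3 * sqrt1-4x (2 ℕ.+ t) - + 2 * sqrt1-4x (3 ℕ.+ t) ∎
  where
  open ≡-Reasoning
  polynomial : ∀ a b → + 2 * (- a + + 2 * b) ≡ + 0 - + 0 + + 0 + + 3 * - (+ 2 * a) - + 2 * - (+ 2 * (a + b))
  polynomial = solve-∀

corollary2p4 : (S : PS) → IsSqrt1-4x S →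
    ∀ n → (mono (+ 2) 1 ⊛ S ⊛ G) n
    ≡ (mono (+ 2) 2 ⊖ mono (+ 7) 1 ⊕ mono (+ 2) 0 ⊕ mono (+ 3) 1 ⊛ S ⊖ mono (+ 2) 0 ⊛ S) n
corollary2p4 S (S0≡1 , _) zero = cong (λ x → + 2 - (+ 2 * x + + 0)) (sym S0≡1)
corollary2p4 S sq (suc m) = begin
    (mono (+ 2) 1 ⊛ S ⊛ G) (suc m)
  ≡⟨ 2xS⊛G-suc S m ⟩
    + 2 * (S ⊛ G) m
  ≡⟨ cong (+ 2 *_) (⊛-congˡ G S≡s m) ⟩
    + 2 * (sqrt1-4x ⊛ G) m
  ≡⟨ sqrt-⊛-G m ⟩
    mono (+ 2) 2 (suc m) - mono (+ 7) 1 (suc m) + mono (+ 2) 0 (suc m) + + 3 * sqrt1-4x m - + 2 * sqrt1-4x (suc m)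
  ≡⟨ cong₂ (λ x y → mono (+ 2) 2 (suc m) - mono (+ 7) 1 (suc m) + mono (+ 2) 0 (suc m) + + 3 * x - + 2 * y)
       (sym (S≡s m)) (sym (S≡s (suc m))) ⟩
    mono (+ 2) 2 (suc m) - mono (+ 7) 1 (suc m) + mono (+ 2) 0 (suc m) + + 3 * S m - + 2 * S (suc m)
  ≡⟨ rhs-suc S m ⟨
    (mono (+ 2) 2 ⊖ mono (+ 7) 1 ⊕ mono (+ 2) 0 ⊕ mono (+ 3) 1 ⊛ S ⊖ mono (+ 2) 0 ⊛ S) (suc m) ∎
  where
  open ≡-Reasoning
  S≡s = sqrt-unique S sq
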